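{- Let $n\ge m\ge 3$. Then $$\mu_{\rm d}(C_n\,\square\,C_m)=\begin{cases}5, & (n,m)\in\{(3,3),(4,3)\},\\ 8, & (n,m)=(4,4),\\ 2, & (n,m)=(5,3),\\ 4, & (n,m)\in\{(5,4),(6,3),(6,4)\},\\ 0, & \text{otherwise}.\end{cases}$$
   Context: $C_n$ is the cycle on $n$ vertices and $C_n\,\square\,C_m$ is the Cartesian product (torus graph). For a graph $G$ and $X\subseteq V(G)$, vertices $u,v\in V(G)$ are $X$-visible if there exists a shortest $u,v$-path $P$ with $V(P)\cap X\subseteq\{u,v\}$. $X$ is a dual mutual-visibility set if every two vertices of $X$ are $X$-visible and every two vertices of $V(G)\setminus X$ are $X$-visible; $\mu_{\rm d}(G)$ is the maximum cardinality of a dual mutual-visibility set of $G$ (the empty set is allowed, so the value may be $0$). -}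

module Defs where

open import Data.Nat using (ℕ; zero; suc; _+_; _≤_; _%_)
open import Data.Nat.ListAction using (sum)
open import Data.Fin using (Fin; toℕ)
open import Data.Bool using (Bool; true; false; if_then_else_)
open import Data.Product using (_×_; _,_; Σ; ∃)
open import Data.Sum using (_⊎_)
open import Data.Empty using (⊥)
open import Data.List using (List; []; _∷_; map; allFin)
open import Data.List.Membership.Propositional using (_∈_)
open import Relation.Binary.PropositionalEquality using (_≡_)

record Graph : Set₁ where
  field
    V   : Set
    Adj : V → V → Set
open Graph public

data Walk (G : Graph) : V G → V G → Set where
  []  : ∀ {u} → Walk G u u
  _∷_ : ∀ {u w v} → Adj G u w → Walk G w v → Walk G u v

len : ∀ {G u v} → Walk G u v → ℕ
len []      = 0
len (_ ∷ p) = suc (len p)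

verts : ∀ {G u v} → Walk G u v → List (V G)
verts {u = u} []      = u ∷ []
verts {u = u} (_ ∷ p) = u ∷ verts p

-- shortest u,v-path: no u,v-walk is strictly shorter
-- (a shortest walk is automatically a path)
IsShortest : ∀ {G u v} → Walk G u v → Set
IsShortest {G} {u} {v} p = ∀ (q : Walk G u v) → len p ≤ len q

Subset : Graph → Set
Subset G = V G → Bool

Visible : (G : Graph) → Subset G → V G → V G → Set
Visible G X u v =
  Σ (Walk G u v) λ p → IsShortest p ×
    (∀ w → w ∈ verts p → X w ≡ true → (w ≡ u ⊎ w ≡ v))

IsDualMV : (G : Graph) → Subset G → Set
IsDualMV G X =
  (∀ u v → X u ≡ true → X v ≡ true → Visible G X u v) ×
  (∀ u v → X u ≡ false → X v ≡ false → Visible G X u v)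

CycAdj : (n : ℕ) → Fin n → Fin n → Set
CycAdj zero    () _
CycAdj (suc k) i j = toℕ j ≡ suc (toℕ i) % suc k ⊎ toℕ i ≡ suc (toℕ j) % suc k

Torus : ℕ → ℕ → Graph
Torus n m = record
  { V   = Fin n × Fin m
  ; Adj = λ { (i , j) (i' , j') →
              (i ≡ i' × CycAdj m j j') ⊎ (j ≡ j' × CycAdj n i i') } }

card : (n m : ℕ) → Subset (Torus n m) → ℕ
card n m X =
  sum (map (λ i → sum (map (λ j → if X (i , j) then 1 else 0) (allFin m))) (allFin n))

MuDTorusIs : (n m k : ℕ) → Set
MuDTorusIs n m k =
  (∃ λ (X : Subset (Torus n m)) → IsDualMV (Torus n m) X × card n m X ≡ k) ×
  (∀ (X : Subset (Torus n m)) → IsDualMV (Torus n m) X → card n m X ≤ k)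

expected : ℕ → ℕ → ℕ
expected 3 3 = 5
expected 4 3 = 5
expected 4 4 = 8
expected 5 3 = 2
expected 5 4 = 4
expected 6 3 = 4
expected 6 4 = 4
expected _ _ = 0

{-# OPTIONS --safe #-}
-- The distance in C_n □ C_m is the sum of the cyclic distances of the two coordinates, and a
-- walk is shortest exactly when its length equals it. For n ≥ 7 take a vertex r₃ of a dual
-- mutual-visibility set Y and the consecutive vertices r₁, …, r₅ of its row: for several pairs
-- among them every geodesic leaves through one single neighbour that lies in Y, so the two
-- vertices of such a pair lie on different sides of Y, and these constraints are contradictory;
-- hence Y = ∅. On the finitely many remaining tori, visibility is decided by walking towards the
-- target one distance-decreasing step at a time, which turns μ_d into a finite search, pruned by
-- testing each pair as soon as the vertices it depends on are decided.

module Submission where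

open import Defs
open import Data.Nat using (ℕ; zero; suc; _+_; _∸_; _⊓_; ∣_-_∣; _≤_; _<_; _%_; _≡ᵇ_; _≤ᵇ_; s≤s; z≤n; s≤s⁻¹; _<?_; _≤?_)
open import Data.Nat.Properties
open import Data.Nat.DivMod using (m%n<n; %-distribˡ-+; m%n%n≡m%n; [m+n]%n≡m%n; m<n⇒m%n≡m; m≤n⇒[n∸m]%m≡n%m)
open import Data.Nat.ListAction using (sum)
open import Data.Bool using (Bool; true; false; T; not; _∧_; _∨_; _xor_; if_then_else_)
open import Data.Bool.Properties using (T-∧; T-∨; T-≡)
open import Data.Bool.ListAction using (any; all)
open import Data.Fin using (Fin; toℕ; fromℕ<; #_)
open import Data.Fin.Properties using (toℕ<n; toℕ-fromℕ<; toℕ-injective)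
open import Data.List using (List; []; _∷_; concatMap; map; allFin; cartesianProduct)
open import Data.List.Properties using (map-cong)
open import Data.List.Membership.Propositional using (_∈_; _∉_; find; lose)
open import Data.List.Membership.Propositional.Properties using (∈-++⁺ˡ; ∈-++⁺ʳ; ∈-allFin; ∈-cartesianProduct⁺)
open import Data.List.Relation.Unary.All as All using (All)
open import Data.List.Relation.Unary.All.Properties using (all⁺; all⁻)
open import Data.List.Relation.Unary.Any as Any using (here; there)
open import Data.List.Relation.Unary.Any.Properties using (any⁺; any⁻)
open import Data.Product using (_×_; _,_; Σ; ∃; proj₁; proj₂)
open import Data.Sum using (_⊎_; inj₁; inj₂)
open import Data.Empty using (⊥; ⊥-elim)
open import Data.Unit using (tt)
open import Function using (_⇔_; Equivalence; mk⇔)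
open import Relation.Nullary using (yes; no; contradiction)
open import Relation.Binary.PropositionalEquality

module _ {a : ℕ} where
  private
    N : ℕ
    N = suc a

  next prev : Fin N → Fin N
  next i = fromℕ< (m%n<n (suc (toℕ i)) N)
  prev i = fromℕ< (m%n<n (toℕ i + a) N)

  next^ : ℕ → Fin N → Fin N
  next^ zero    i = i
  next^ (suc t) i = next^ t (next i)

  cdist : Fin N → Fin N → ℕ
  cdist i j = ∣ toℕ i - toℕ j ∣ ⊓ (N ∸ ∣ toℕ i - toℕ j ∣)

  private
    %-absorbˡ : ∀ x y → (x % N + y) % N ≡ (x + y) % N
    %-absorbˡ x y = begin
      (x % N + y) % N          ≡⟨ %-distribˡ-+ (x % N) y N ⟩
      (x % N % N + y % N) % N  ≡⟨ cong (λ z → (z + y % N) % N) (m%n%n≡m%n x N) ⟩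
      (x % N + y % N) % N      ≡⟨ %-distribˡ-+ x y N ⟨
      (x + y) % N              ∎
      where open ≡-Reasoning

    %-absorbʳ : ∀ x y → (x + y % N) % N ≡ (x + y) % N
    %-absorbʳ x y = begin
      (x + y % N) % N  ≡⟨ cong (_% N) (+-comm x (y % N)) ⟩
      (y % N + x) % N  ≡⟨ %-absorbˡ y x ⟩
      (y + x) % N      ≡⟨ cong (_% N) (+-comm y x) ⟩
      (x + y) % N      ∎
      where open ≡-Reasoning

    [m+N]%N≡m : ∀ x → x < N → (x + N) % N ≡ x
    [m+N]%N≡m x x<N = trans ([m+n]%n≡m%n x N) (m<n⇒m%n≡m x<N)

  toℕ-next : ∀ i → toℕ (next i) ≡ suc (toℕ i) % N
  toℕ-next i = toℕ-fromℕ< _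

  toℕ-prev : ∀ i → toℕ (prev i) ≡ (toℕ i + a) % N
  toℕ-prev i = toℕ-fromℕ< _

  next-prev : ∀ i → next (prev i) ≡ i
  next-prev i = toℕ-injective (begin
    toℕ (next (prev i))        ≡⟨ toℕ-next (prev i) ⟩
    suc (toℕ (prev i)) % N     ≡⟨ cong (λ z → suc z % N) (toℕ-prev i) ⟩
    (1 + (toℕ i + a) % N) % N  ≡⟨ %-absorbʳ 1 (toℕ i + a) ⟩
    suc (toℕ i + a) % N        ≡⟨ cong (_% N) (+-suc (toℕ i) a) ⟨
    (toℕ i + N) % N            ≡⟨ [m+N]%N≡m (toℕ i) (toℕ<n i) ⟩
    toℕ i                      ∎)
    where open ≡-Reasoning

  prev-next : ∀ i → prev (next i) ≡ i
  prev-next i = toℕ-injective (begin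
    toℕ (prev (next i))        ≡⟨ toℕ-prev (next i) ⟩
    (toℕ (next i) + a) % N     ≡⟨ cong (λ z → (z + a) % N) (toℕ-next i) ⟩
    (suc (toℕ i) % N + a) % N  ≡⟨ %-absorbˡ (suc (toℕ i)) a ⟩
    suc (toℕ i + a) % N        ≡⟨ cong (_% N) (+-suc (toℕ i) a) ⟨
    (toℕ i + N) % N            ≡⟨ [m+N]%N≡m (toℕ i) (toℕ<n i) ⟩
    toℕ i                      ∎)
    where open ≡-Reasoning

  CycAdj-next : ∀ i → CycAdj N i (next i)
  CycAdj-next i = inj₁ (toℕ-next i)

  CycAdj-prev : ∀ i → CycAdj N i (prev i)
  CycAdj-prev i = inj₂ (trans (cong toℕ (sym (next-prev i))) (toℕ-next (prev i)))

  CycAdj⇒next⊎prev : ∀ {i j} → CycAdj N i j → j ≡ next i ⊎ j ≡ prev i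
  CycAdj⇒next⊎prev {i} {j} (inj₁ e) = inj₁ (toℕ-injective (trans e (sym (toℕ-next i))))
  CycAdj⇒next⊎prev {i} {j} (inj₂ e) =
    inj₂ (trans (sym (prev-next j)) (cong prev (sym (toℕ-injective (trans e (sym (toℕ-next j)))))))

  CycAdj-sym : ∀ {i j} → CycAdj N i j → CycAdj N j i
  CycAdj-sym (inj₁ e) = inj₂ e
  CycAdj-sym (inj₂ e) = inj₁ e

  toℕ-next^ : ∀ t i → toℕ (next^ t i) ≡ (toℕ i + t) % N
  toℕ-next^ zero    i = sym (trans (cong (_% N) (+-identityʳ (toℕ i))) (m<n⇒m%n≡m (toℕ<n i)))
  toℕ-next^ (suc t) i = begin
    toℕ (next^ t (next i))         ≡⟨ toℕ-next^ t (next i) ⟩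
    (toℕ (next i) + t) % N         ≡⟨ cong (λ z → (z + t) % N) (toℕ-next i) ⟩
    (suc (toℕ i) % N + t) % N      ≡⟨ %-absorbˡ (suc (toℕ i)) t ⟩
    (suc (toℕ i) + t) % N          ≡⟨ cong (_% N) (+-suc (toℕ i) t) ⟨
    (toℕ i + suc t) % N            ∎
    where open ≡-Reasoning

  next^-+ : ∀ s t i → next^ (s + t) i ≡ next^ t (next^ s i)
  next^-+ zero    t i = refl
  next^-+ (suc s) t i = next^-+ s t (next i)

  next^-suc : ∀ s i → next^ (suc s) i ≡ next (next^ s i)
  next^-suc s i = trans (cong (λ t → next^ t i) (+-comm 1 s)) (next^-+ s 1 i)

  next^-period : ∀ i → next^ N i ≡ i
  next^-period i = toℕ-injective (trans (toℕ-next^ N i) ([m+N]%N≡m (toℕ i) (toℕ<n i)))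

  next^-reach : ∀ i j → ∃ λ d → d < N × next^ d i ≡ j
  next^-reach i j = d , m%n<n (y + (N ∸ x)) N , toℕ-injective (begin
    toℕ (next^ d i)              ≡⟨ toℕ-next^ d i ⟩
    (x + (y + (N ∸ x)) % N) % N  ≡⟨ %-absorbʳ x (y + (N ∸ x)) ⟩
    (x + (y + (N ∸ x))) % N      ≡⟨ cong (_% N) (x+[y+[N∸x]]≡y+N) ⟩
    (y + N) % N                  ≡⟨ [m+N]%N≡m y (toℕ<n j) ⟩
    y                            ∎)
    where
    open ≡-Reasoning
    x = toℕ i
    y = toℕ j
    d = (y + (N ∸ x)) % N
    x+[y+[N∸x]]≡y+N : x + (y + (N ∸ x)) ≡ y + N
    x+[y+[N∸x]]≡y+N = begin
      x + (y + (N ∸ x))  ≡⟨ +-comm x _ ⟩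
      y + (N ∸ x) + x    ≡⟨ +-assoc y (N ∸ x) x ⟩
      y + (N ∸ x + x)    ≡⟨ cong (y +_) (m∸n+n≡m (<⇒≤ (toℕ<n i))) ⟩
      y + N              ∎

  cdist-comm : ∀ i j → cdist i j ≡ cdist j i
  cdist-comm i j rewrite ∣-∣-comm (toℕ i) (toℕ j) = refl

  private
    wrapped≤ : ∀ x d → d < N → x + d ∸ N ≤ x
    wrapped≤ x d d<N = ≤-trans (∸-monoˡ-≤ N (+-monoʳ-≤ x (<⇒≤ d<N))) (≤-reflexive (m+n∸n≡m x N))

    ∸wrapped : ∀ x d → N ≤ x + d → x ∸ (x + d ∸ N) ≡ N ∸ d
    ∸wrapped x d N≤x+d = begin
      x ∸ e              ≡⟨ [m+n]∸[m+o]≡n∸o d x e ⟨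
      (d + x) ∸ (d + e)  ≡⟨ cong₂ _∸_ d+x≡e+N (+-comm d e) ⟩
      (e + N) ∸ (e + d)  ≡⟨ [m+n]∸[m+o]≡n∸o e N d ⟩
      N ∸ d              ∎
      where
      open ≡-Reasoning
      e = x + d ∸ N
      d+x≡e+N : d + x ≡ e + N
      d+x≡e+N = trans (+-comm d x) (sym (trans (+-comm e N) (m+[n∸m]≡n N≤x+d)))

  cdist-next^ : ∀ i d → d < N → cdist i (next^ d i) ≡ d ⊓ (N ∸ d)
  cdist-next^ i d d<N rewrite toℕ-next^ d i with toℕ i + d <? N
  ... | yes x+d<N rewrite m<n⇒m%n≡m x+d<N | ∣m-m+n∣≡n (toℕ i) d = refl
  ... | no x+d≮N
    rewrite sym (m≤n⇒[n∸m]%m≡n%m {N} (≮⇒≥ x+d≮N))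
          | m<n⇒m%n≡m (≤-<-trans (wrapped≤ (toℕ i) d d<N) (toℕ<n i))
          | m≤n⇒∣n-m∣≡n∸m (wrapped≤ (toℕ i) d d<N)
          | ∸wrapped (toℕ i) d (≮⇒≥ x+d≮N)
          | m∸[m∸n]≡n (<⇒≤ d<N)
          = ⊓-comm (N ∸ d) d

  cdist-self : ∀ i → cdist i i ≡ 0
  cdist-self i rewrite ∣n-n∣≡0 (toℕ i) = refl

  cdist≡0⇒≡ : ∀ {i j} → cdist i j ≡ 0 → i ≡ j
  cdist≡0⇒≡ {i} {j} eq with next^-reach i j
  ... | zero  , _   , refl = refl
  ... | suc e , d<N , refl =
    contradiction (trans (sym (cdist-next^ i (suc e) d<N)) eq) (>⇒≢ (⊓-glb (s≤s z≤n) (m<n⇒0<n∸m d<N)))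

  private
    ⊓∸-step : ∀ e → suc e ≤ N →
              suc e ⊓ (N ∸ suc e) ≤ suc (e ⊓ (N ∸ e)) × e ⊓ (N ∸ e) ≤ suc (suc e ⊓ (N ∸ suc e))
    ⊓∸-step e e<N =
      ⊓-mono-≤ ≤-refl (≤-trans (∸-monoʳ-≤ N (n≤1+n e)) (n≤1+n (N ∸ e))) ,
      ⊓-mono-≤ (≤-trans (n≤1+n e) (n≤1+n (suc e))) (≤-reflexive (+-∸-assoc 1 e<N))

  cdist-next-≤ : ∀ i t → cdist i t ≤ suc (cdist (next i) t) × cdist (next i) t ≤ suc (cdist i t)
  cdist-next-≤ i t with next^-reach i t
  ... | zero , _ , refl rewrite cdist-self i = z≤n , (begin
    cdist (next i) i                   ≡⟨ cong (cdist (next i)) (next^-period i) ⟨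
    cdist (next i) (next^ a (next i))  ≡⟨ cdist-next^ (next i) a ≤-refl ⟩
    a ⊓ (N ∸ a)                        ≤⟨ m⊓n≤n a (N ∸ a) ⟩
    N ∸ a                              ≡⟨ m+n∸n≡m 1 a ⟩
    1                                  ∎)
    where open ≤-Reasoning
  ... | suc e , d<N , refl
    rewrite cdist-next^ i (suc e) d<N | cdist-next^ (next i) e (<⇒≤ d<N) = ⊓∸-step e (<⇒≤ d<N)

  cdist-CycAdj : ∀ {i i'} t → CycAdj N i i' → cdist i t ≤ suc (cdist i' t)
  cdist-CycAdj {i} t adj with CycAdj⇒next⊎prev adj
  ... | inj₁ refl = proj₁ (cdist-next-≤ i t)
  ... | inj₂ refl =
    subst (λ z → cdist z t ≤ suc (cdist (prev i) t)) (next-prev i) (proj₂ (cdist-next-≤ (prev i) t))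

  cycle-geodesic : ∀ i j → next^ (cdist i j) i ≡ j ⊎ next^ (cdist i j) j ≡ i
  cycle-geodesic i j with next^-reach i j
  ... | d , d<N , refl rewrite cdist-next^ i d d<N with d ≤? N ∸ d
  ...   | yes d≤N∸d rewrite m≤n⇒m⊓n≡m d≤N∸d = inj₁ refl
  ...   | no d≰N∸d rewrite m≥n⇒m⊓n≡n (<⇒≤ (≰⇒> d≰N∸d)) = inj₂ (begin
    next^ (N ∸ d) (next^ d i)  ≡⟨ next^-+ d (N ∸ d) i ⟨
    next^ (d + (N ∸ d)) i      ≡⟨ cong (λ s → next^ s i) (m+[n∸m]≡n (<⇒≤ d<N)) ⟩
    next^ N i                  ≡⟨ next^-period i ⟩
    i                          ∎)
    where open ≡-Reasoning

module TorusGeometry (k l : ℕ) where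

  n m : ℕ
  n = suc k
  m = suc l

  G : Graph
  G = Torus n m

  Vertex : Set
  Vertex = Fin n × Fin m

  dist : Vertex → Vertex → ℕ
  dist (i , j) (i' , j') = cdist i i' + cdist j j'

  dist-self : ∀ u → dist u u ≡ 0
  dist-self (i , j) rewrite cdist-self i | cdist-self j = refl

  dist-comm : ∀ u v → dist u v ≡ dist v u
  dist-comm (i , j) (i' , j') = cong₂ _+_ (cdist-comm i i') (cdist-comm j j')

  dist≡0⇒≡ : ∀ {u v} → dist u v ≡ 0 → u ≡ v
  dist≡0⇒≡ {i , j} {i' , j'} eq =
    cong₂ _,_ (cdist≡0⇒≡ (m+n≡0⇒m≡0 _ eq)) (cdist≡0⇒≡ (m+n≡0⇒n≡0 (cdist i i') eq))

  dist-Adj : ∀ {u w} t → Adj G u w → dist u t ≤ suc (dist w t)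
  dist-Adj {i , j} (t , t') (inj₁ (refl , adj)) =
    ≤-trans (+-monoʳ-≤ (cdist i t) (cdist-CycAdj t' adj)) (≤-reflexive (+-suc _ _))
  dist-Adj {i , j} (t , t') (inj₂ (refl , adj)) = +-monoˡ-≤ (cdist j t') (cdist-CycAdj t adj)

  dist≤len : ∀ {u v} (p : Walk G u v) → dist u v ≤ len p
  dist≤len {u} []           = ≤-reflexive (dist-self u)
  dist≤len {v = v} (adj ∷ p) = ≤-trans (dist-Adj v adj) (s≤s (dist≤len p))

  start∈verts : ∀ {u v} (p : Walk G u v) → u ∈ verts p
  start∈verts []      = here refl
  start∈verts (_ ∷ _) = here refl

  dist≤len-from : ∀ {u v z} (p : Walk G u v) → z ∈ verts p → dist z v ≤ len p
  dist≤len-from {v = v} []  (here refl)  = ≤-reflexive (dist-self v)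
  dist≤len-from (adj ∷ p)   (here refl)  = dist≤len (adj ∷ p)
  dist≤len-from (adj ∷ p)   (there z∈p) = ≤-trans (dist≤len-from p z∈p) (n≤1+n _)

  Adj-sym : ∀ {u w} → Adj G u w → Adj G w u
  Adj-sym (inj₁ (refl , adj)) = inj₁ (refl , CycAdj-sym adj)
  Adj-sym (inj₂ (refl , adj)) = inj₂ (refl , CycAdj-sym adj)

  _++ᵂ_ : ∀ {u v w} → Walk G u v → Walk G v w → Walk G u w
  []        ++ᵂ q = q
  (adj ∷ p) ++ᵂ q = adj ∷ (p ++ᵂ q)

  len-++ᵂ : ∀ {u v w} (p : Walk G u v) (q : Walk G v w) → len (p ++ᵂ q) ≡ len p + len q
  len-++ᵂ []        q = refl
  len-++ᵂ (adj ∷ p) q = cong suc (len-++ᵂ p q)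

  reverseᵂ : ∀ {u v} → Walk G u v → Walk G v u
  reverseᵂ []        = []
  reverseᵂ (adj ∷ p) = reverseᵂ p ++ᵂ (Adj-sym adj ∷ [])

  len-reverseᵂ : ∀ {u v} (p : Walk G u v) → len (reverseᵂ p) ≡ len p
  len-reverseᵂ []        = refl
  len-reverseᵂ (adj ∷ p) =
    trans (len-++ᵂ (reverseᵂ p) _) (trans (+-comm (len (reverseᵂ p)) 1) (cong suc (len-reverseᵂ p)))

  rowWalk : ∀ c i j → Walk G (i , j) (next^ c i , j)
  rowWalk zero    i j = []
  rowWalk (suc c) i j = inj₂ (refl , CycAdj-next i) ∷ rowWalk c (next i) j

  columnWalk : ∀ c i j → Walk G (i , j) (i , next^ c j)
  columnWalk zero    i j = []
  columnWalk (suc c) i j = inj₁ (refl , CycAdj-next j) ∷ columnWalk c i (next j)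

  len-rowWalk : ∀ c i j → len (rowWalk c i j) ≡ c
  len-rowWalk zero    i j = refl
  len-rowWalk (suc c) i j = cong suc (len-rowWalk c (next i) j)

  len-columnWalk : ∀ c i j → len (columnWalk c i j) ≡ c
  len-columnWalk zero    i j = refl
  len-columnWalk (suc c) i j = cong suc (len-columnWalk c i (next j))

  rowGeodesic : ∀ i i' j → Σ (Walk G (i , j) (i' , j)) λ p → len p ≡ cdist i i'
  rowGeodesic i i' j with cdist i i' | cycle-geodesic i i'
  ... | c | inj₁ refl = rowWalk c i j , len-rowWalk c i j
  ... | c | inj₂ refl = reverseᵂ (rowWalk c i' j) , trans (len-reverseᵂ (rowWalk c i' j)) (len-rowWalk c i' j)

  columnGeodesic : ∀ i j j' → Σ (Walk G (i , j) (i , j')) λ p → len p ≡ cdist j j'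
  columnGeodesic i j j' with cdist j j' | cycle-geodesic j j'
  ... | c | inj₁ refl = columnWalk c i j , len-columnWalk c i j
  ... | c | inj₂ refl = reverseᵂ (columnWalk c i j') , trans (len-reverseᵂ (columnWalk c i j')) (len-columnWalk c i j')

  geodesic : ∀ u v → Σ (Walk G u v) λ p → len p ≡ dist u v
  geodesic (i , j) (i' , j') =
    let p , len-p = rowGeodesic i i' j
        q , len-q = columnGeodesic i' j j'
    in p ++ᵂ q , trans (len-++ᵂ p q) (cong₂ _+_ len-p len-q)

  len≡dist⇒shortest : ∀ {u v} (p : Walk G u v) → len p ≡ dist u v → IsShortest p
  len≡dist⇒shortest p len≡dist q = ≤-trans (≤-reflexive len≡dist) (dist≤len q)

  shortest⇒len≡dist : ∀ {u v} (p : Walk G u v) → IsShortest p → len p ≡ dist u v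
  shortest⇒len≡dist {u} {v} p shortest =
    ≤-antisym (≤-trans (shortest (proj₁ (geodesic u v))) (≤-reflexive (proj₂ (geodesic u v)))) (dist≤len p)

module TorusSubsets (k l : ℕ) where

  open TorusGeometry k l

  ∅ : Subset G
  ∅ _ = false

  card-cong : ∀ X Y → (∀ w → X w ≡ Y w) → card n m X ≡ card n m Y
  card-cong X Y X≗Y =
    cong sum (map-cong (λ i → cong sum (map-cong (λ j → cong (λ b → if b then 1 else 0) (X≗Y (i , j))) (allFin m))) (allFin n))

  card-∅ : card n m ∅ ≡ 0
  card-∅ = trans (cong sum (map-cong (λ i → sum-zeros (allFin m)) (allFin n))) (sum-zeros (allFin n))
    where
    sum-zeros : ∀ {A : Set} (xs : List A) → sum (map (λ _ → 0) xs) ≡ 0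
    sum-zeros []       = refl
    sum-zeros (_ ∷ xs) = sum-zeros xs

  ∅-IsDualMV : IsDualMV G ∅
  ∅-IsDualMV = (λ _ _ ()) , λ u v _ _ →
    let p , len-p = geodesic u v in p , len≡dist⇒shortest p len-p , λ _ _ ()

  only-∅⇒μ≡0 : (∀ Y → IsDualMV G Y → ∀ w → Y w ≡ false) → MuDTorusIs n m 0
  only-∅⇒μ≡0 only-∅ = (∅ , ∅-IsDualMV , card-∅) ,
    λ Y dmv → ≤-reflexive (trans (card-cong Y ∅ (only-∅ Y dmv)) card-∅)

module TorusVisibility (k l : ℕ) where

  open TorusGeometry k l
  open Equivalence

  neighbours : Vertex → List Vertex
  neighbours (i , j) = (next i , j) ∷ (prev i , j) ∷ (i , next j) ∷ (i , prev j) ∷ []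

  ∈-neighbours⇒Adj : ∀ {u w} → w ∈ neighbours u → Adj G u w
  ∈-neighbours⇒Adj {i , j} (here refl)                         = inj₂ (refl , CycAdj-next i)
  ∈-neighbours⇒Adj {i , j} (there (here refl))                 = inj₂ (refl , CycAdj-prev i)
  ∈-neighbours⇒Adj {i , j} (there (there (here refl)))         = inj₁ (refl , CycAdj-next j)
  ∈-neighbours⇒Adj {i , j} (there (there (there (here refl)))) = inj₁ (refl , CycAdj-prev j)

  Adj⇒∈-neighbours : ∀ {u w} → Adj G u w → w ∈ neighbours u
  Adj⇒∈-neighbours (inj₁ (refl , adj)) with CycAdj⇒next⊎prev adj
  ... | inj₁ refl = there (there (here refl))
  ... | inj₂ refl = there (there (there (here refl)))
  Adj⇒∈-neighbours (inj₂ (refl , adj)) with CycAdj⇒next⊎prev adj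
  ... | inj₁ refl = here refl
  ... | inj₂ refl = there (here refl)

  InteriorAvoids : Subset G → ∀ {u v} → Walk G u v → Set
  InteriorAvoids X {u} {v} p = ∀ z → z ∈ verts p → X z ≡ true → z ≡ u ⊎ z ≡ v

  mutual
    geodesicAvoidsᵇ : Subset G → ℕ → Vertex → Vertex → Bool
    geodesicAvoidsᵇ X zero    u v = true
    geodesicAvoidsᵇ X (suc d) u v = any (avoidingStepᵇ X d v) (neighbours u)

    -- The last step lands on v itself, which may lie in X: hence the test d ≡ᵇ 0.
    avoidingStepᵇ : Subset G → ℕ → Vertex → Vertex → Bool
    avoidingStepᵇ X d v w = (dist w v ≡ᵇ d) ∧ (((d ≡ᵇ 0) ∨ not (X w)) ∧ geodesicAvoidsᵇ X d w v)

  geodesicAvoidsᵇ-sound : ∀ X d {u v} → dist u v ≡ d → T (geodesicAvoidsᵇ X d u v) →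
                          Σ (Walk G u v) λ p → len p ≡ d × InteriorAvoids X p
  geodesicAvoidsᵇ-sound X zero    {u} {v} dist≡0 _ with dist≡0⇒≡ {u} {v} dist≡0
  ... | refl = [] , refl , λ { _ (here z≡u) _ → inj₁ z≡u }
  geodesicAvoidsᵇ-sound X (suc d) {u} {v} _ found
    with find (any⁻ (avoidingStepᵇ X d v) (neighbours u) found)
  ... | w , w∈ , step-w
    with to T-∧ step-w
  ... | dist≡d , rest
    with to T-∧ rest
  ... | last∨free , rest′
    with geodesicAvoidsᵇ-sound X d (≡ᵇ⇒≡ (dist w v) d dist≡d) rest′
  ... | p , len-p , avoids = ∈-neighbours⇒Adj w∈ ∷ p , cong suc len-p , avoids′
    where
    avoids′ : InteriorAvoids X (∈-neighbours⇒Adj w∈ ∷ p)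
    avoids′ z (here refl) _ = inj₁ refl
    avoids′ z (there z∈p) Xz with avoids z z∈p Xz
    ... | inj₂ z≡v  = inj₂ z≡v
    ... | inj₁ refl with to T-∨ last∨free
    ...   | inj₁ d≡0 = inj₂ (dist≡0⇒≡ (trans (≡ᵇ⇒≡ (dist w v) d dist≡d) (≡ᵇ⇒≡ d 0 d≡0)))
    ...   | inj₂ ¬Xw = ⊥-elim (subst (λ b → T (not b)) Xz ¬Xw)

  geodesicAvoidsᵇ-complete : ∀ X {u v} (p : Walk G u v) → len p ≡ dist u v → InteriorAvoids X p →
                             T (geodesicAvoidsᵇ X (len p) u v)
  geodesicAvoidsᵇ-complete X []                          _       _      = tt
  geodesicAvoidsᵇ-complete X {u} {v} (_∷_ {w = w} adj p) len≡dist avoids =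
    any⁺ (avoidingStepᵇ X (len p) v) (lose (Adj⇒∈-neighbours adj)
      (from T-∧ (≡⇒≡ᵇ (dist w v) (len p) dist-w ,
       from T-∧ (last∨free , geodesicAvoidsᵇ-complete X p (sym dist-w) avoids-p))))
    where
    dist-w : dist w v ≡ len p
    dist-w = ≤-antisym (dist≤len p) (s≤s⁻¹ (≤-trans (≤-reflexive len≡dist) (dist-Adj v adj)))

    u∉p : ∀ {z} → z ∈ verts p → z ≢ u
    u∉p z∈p refl = <⇒≱ (≤-reflexive len≡dist) (dist≤len-from p z∈p)

    avoids-p : InteriorAvoids X p
    avoids-p z z∈p Xz with avoids z (there z∈p) Xz
    ... | inj₁ z≡u = contradiction z≡u (u∉p z∈p)
    ... | inj₂ z≡v = inj₂ z≡v

    last∨free : T ((len p ≡ᵇ 0) ∨ not (X w))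
    last∨free with X w in Xw
    ... | false = from T-∨ (inj₂ tt)
    ... | true with avoids w (there (start∈verts p)) Xw
    ...   | inj₁ w≡u = contradiction w≡u (u∉p (start∈verts p))
    ...   | inj₂ refl = from T-∨ (inj₁ (≡⇒≡ᵇ (len p) 0 (trans (sym dist-w) (dist-self w))))

  visibleᵇ : Subset G → Vertex → Vertex → Bool
  visibleᵇ X u v = geodesicAvoidsᵇ X (dist u v) u v

  visibleᵇ⇔Visible : ∀ X u v → T (visibleᵇ X u v) ⇔ Visible G X u v
  visibleᵇ⇔Visible X u v = mk⇔
    (λ vis → let p , len-p , avoids = geodesicAvoidsᵇ-sound X (dist u v) refl vis
             in p , len≡dist⇒shortest p len-p , avoids)
    (λ { (p , shortest , avoids) → let len-p = shortest⇒len≡dist p shortest in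
         subst (λ d → T (geodesicAvoidsᵇ X d u v)) len-p (geodesicAvoidsᵇ-complete X p len-p avoids) })

module TorusSearch (k l : ℕ) where

  open TorusGeometry k l
  open TorusVisibility k l
  open TorusSubsets k l

  _==_ : Vertex → Vertex → Bool
  (i , j) == (i′ , j′) = (toℕ i ≡ᵇ toℕ i′) ∧ (toℕ j ≡ᵇ toℕ j′)

  ==⇒≡ : ∀ u v → T (u == v) → u ≡ v
  ==⇒≡ (i , j) (i′ , j′) eq =
    let ei , ej = Equivalence.to T-∧ eq
    in cong₂ _,_ (toℕ-injective (≡ᵇ⇒≡ _ _ ei)) (toℕ-injective (≡ᵇ⇒≡ _ _ ej))

  ==-refl : ∀ u → T (u == u)
  ==-refl (i , j) = Equivalence.from T-∧ (≡⇒≡ᵇ (toℕ i) (toℕ i) refl , ≡⇒≡ᵇ (toℕ j) (toℕ j) refl)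

  _∈ᵇ_ : Vertex → List Vertex → Bool
  w ∈ᵇ vs = any (w ==_) vs

  ∈⇒∈ᵇ : ∀ {w vs} → w ∈ vs → T (w ∈ᵇ vs)
  ∈⇒∈ᵇ {w} w∈vs = any⁺ (w ==_) (Any.map (λ { refl → ==-refl w }) w∈vs)

  ∉ᵇ⇒∉ : ∀ {w vs} → T (not (w ∈ᵇ vs)) → w ∉ vs
  ∉ᵇ⇒∉ w∉ᵇvs w∈vs = subst (λ b → T (not b)) (Equivalence.to T-≡ (∈⇒∈ᵇ w∈vs)) w∉ᵇvs

  mutual
    probed : ℕ → Vertex → Vertex → List Vertex
    probed zero    u v = []
    probed (suc d) u v = concatMap (probedFrom d v) (neighbours u)

    probedFrom : ℕ → Vertex → Vertex → List Vertex
    probedFrom d v w = if dist w v ≡ᵇ d then w ∷ probed d w v else []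

  Agree : Subset G → Subset G → List Vertex → Set
  Agree X Y ws = ∀ w → w ∈ ws → X w ≡ Y w

  mutual
    geodesicAvoidsᵇ-cong : ∀ X Y d u v → Agree X Y (probed d u v) → geodesicAvoidsᵇ X d u v ≡ geodesicAvoidsᵇ Y d u v
    geodesicAvoidsᵇ-cong X Y zero    u v _     = refl
    geodesicAvoidsᵇ-cong X Y (suc d) u v agree = any-cong X Y d v (neighbours u) agree

    any-cong : ∀ X Y d v ws → Agree X Y (concatMap (probedFrom d v) ws) →
               any (avoidingStepᵇ X d v) ws ≡ any (avoidingStepᵇ Y d v) ws
    any-cong X Y d v []       _     = refl
    any-cong X Y d v (w ∷ ws) agree =
      cong₂ _∨_ (avoidingStepᵇ-cong X Y d v w (λ z z∈ → agree z (∈-++⁺ˡ z∈)))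
                (any-cong X Y d v ws (λ z z∈ → agree z (∈-++⁺ʳ (probedFrom d v w) z∈)))

    avoidingStepᵇ-cong : ∀ X Y d v w → Agree X Y (probedFrom d v w) → avoidingStepᵇ X d v w ≡ avoidingStepᵇ Y d v w
    avoidingStepᵇ-cong X Y d v w agree with dist w v ≡ᵇ d
    ... | false = refl
    ... | true rewrite agree w (here refl) | geodesicAvoidsᵇ-cong X Y d w v (λ z z∈ → agree z (there z∈)) = refl

  satisfiedᵇ : Subset G → Vertex × Vertex → Bool
  satisfiedᵇ X (u , v) = (X u xor X v) ∨ visibleᵇ X u v

  support : Vertex × Vertex → List Vertex
  support (u , v) = u ∷ v ∷ probed (dist u v) u v

  satisfiedᵇ-cong : ∀ X Y c → Agree X Y (support c) → satisfiedᵇ X c ≡ satisfiedᵇ Y c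
  satisfiedᵇ-cong X Y (u , v) agree
    rewrite agree u (here refl) | agree v (there (here refl))
          | geodesicAvoidsᵇ-cong X Y (dist u v) u v (λ w w∈ → agree w (there (there w∈))) = refl

  IsDualMV⇒satisfiedᵇ : ∀ {Y} → IsDualMV G Y → ∀ c → T (satisfiedᵇ Y c)
  IsDualMV⇒satisfiedᵇ {Y} (inside , outside) (u , v) with Y u in Yu | Y v in Yv
  ... | true  | true  = Equivalence.from (visibleᵇ⇔Visible Y u v) (inside u v Yu Yv)
  ... | true  | false = _
  ... | false | true  = _
  ... | false | false = Equivalence.from (visibleᵇ⇔Visible Y u v) (outside u v Yu Yv)

  settledᵇ : List Vertex → Vertex × Vertex → Bool
  settledᵇ vs c = all (λ w → not (w ∈ᵇ vs)) (support c)

  settled⇒satisfiedᵇ : ∀ {X Y} → IsDualMV G Y → ∀ vs → (∀ w → w ∉ vs → X w ≡ Y w) →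
                       ∀ c → T (settledᵇ vs c) → T (satisfiedᵇ X c)
  settled⇒satisfiedᵇ {X} {Y} dmv vs agree c settled =
    subst T (sym (satisfiedᵇ-cong X Y c agree-c)) (IsDualMV⇒satisfiedᵇ dmv c)
    where
    agree-c : Agree X Y (support c)
    agree-c w w∈ = agree w (∉ᵇ⇒∉ (All.lookup (all⁺ (λ z → not (z ∈ᵇ vs)) (support c) settled) w∈))

  satisfiedᵇ⇒Visible : ∀ X u v → X u ≡ X v → T (satisfiedᵇ X (u , v)) → Visible G X u v
  satisfiedᵇ⇒Visible X u v Xu≡Xv sat rewrite Xu≡Xv with X v
  ... | true  = Equivalence.to (visibleᵇ⇔Visible X u v) sat
  ... | false = Equivalence.to (visibleᵇ⇔Visible X u v) sat

  allVertices : List Vertex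
  allVertices = cartesianProduct (allFin n) (allFin m)

  ∈-allVertices : ∀ w → w ∈ allVertices
  ∈-allVertices (i , j) = ∈-cartesianProduct⁺ (∈-allFin i) (∈-allFin j)

  allPairs : List (Vertex × Vertex)
  allPairs = cartesianProduct allVertices allVertices

  all-satisfiedᵇ⇒IsDualMV : ∀ X → T (all (satisfiedᵇ X) allPairs) → IsDualMV G X
  all-satisfiedᵇ⇒IsDualMV X sat = visible , visible
    where
    visible : ∀ {b} u v → X u ≡ b → X v ≡ b → Visible G X u v
    visible u v Xu Xv = satisfiedᵇ⇒Visible X u v (trans Xu (sym Xv))
      (All.lookup (all⁺ (satisfiedᵇ X) allPairs sat) (∈-cartesianProduct⁺ (∈-allVertices u) (∈-allVertices v)))

  _[_≔_] : Subset G → Vertex → Bool → Subset G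
  (X [ v ≔ b ]) w = if w == v then b else X w

  -- Soundness needs scheduledᵇ: the
  -- pairs tested after v depend only on v and on the vertices decided before it.
  boundedᵇ : ℕ → List Vertex → List (List (Vertex × Vertex)) → Subset G → Bool
  boundedᵇ K []       _          X = card n m X ≤ᵇ K
  boundedᵇ K (_ ∷ _)  []         X = false
  boundedᵇ K (v ∷ vs) (cs ∷ css) X = branch (X [ v ≔ false ]) ∧ branch (X [ v ≔ true ])
    where
    branch : Subset G → Bool
    branch Y = if all (satisfiedᵇ Y) cs then boundedᵇ K vs css Y else true

  scheduledᵇ : List Vertex → List (List (Vertex × Vertex)) → Bool
  scheduledᵇ []       _          = true
  scheduledᵇ (_ ∷ _)  []         = true
  scheduledᵇ (v ∷ vs) (cs ∷ css) = all (settledᵇ vs) cs ∧ scheduledᵇ vs css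

  private
    T-if : ∀ {b x} → T b → T (if b then x else true) → T x
    T-if {true} _ t = t

  boundedᵇ-sound : ∀ {K Y} → IsDualMV G Y → ∀ vs css X → T (scheduledᵇ vs css) →
                   (∀ w → w ∉ vs → X w ≡ Y w) → T (boundedᵇ K vs css X) → card n m Y ≤ K
  boundedᵇ-sound {K} {Y} _ [] _ X _ agree bounded =
    ≤-trans (≤-reflexive (card-cong Y X (λ w → sym (agree w λ ())))) (≤ᵇ⇒≤ (card n m X) K bounded)
  boundedᵇ-sound _ (_ ∷ _) [] _ _ _ ()
  boundedᵇ-sound {K} {Y} dmv (v ∷ vs) (cs ∷ css) X scheduled agree bounded =
    boundedᵇ-sound dmv vs css X′ (proj₂ scheduled′) agree′ (T-if satisfied branch)
    where
    scheduled′ : T (all (settledᵇ vs) cs) × T (scheduledᵇ vs css)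
    scheduled′ = Equivalence.to T-∧ scheduled

    X′ : Subset G
    X′ = X [ v ≔ Y v ]

    agree′ : ∀ w → w ∉ vs → X′ w ≡ Y w
    agree′ w w∉vs with w == v in w==v
    ... | true  = cong Y (sym (==⇒≡ w v (Equivalence.from T-≡ w==v)))
    ... | false = agree w λ { (here refl) → subst T w==v (==-refl w) ; (there w∈vs) → w∉vs w∈vs }

    satisfied : T (all (satisfiedᵇ X′) cs)
    satisfied = all⁻ (satisfiedᵇ X′)
      (All.map (λ {c} → settled⇒satisfiedᵇ dmv vs agree′ c) (all⁺ (settledᵇ vs) cs (proj₁ scheduled′)))

    branch : T (if all (satisfiedᵇ X′) cs then boundedᵇ K vs css X′ else true)
    branch with Y v | Equivalence.to T-∧ bounded
    ... | false | b , _ = b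
    ... | true  | _ , b = b

  certified-upper-bound : ∀ K css → T (scheduledᵇ allVertices css) → T (boundedᵇ K allVertices css ∅) →
                          ∀ Y → IsDualMV G Y → card n m Y ≤ K
  certified-upper-bound K css scheduled bounded Y dmv =
    boundedᵇ-sound dmv allVertices css ∅ scheduled (λ w w∉ → ⊥-elim (w∉ (∈-allVertices w))) bounded

  members : List Vertex → Subset G
  members ws w = w ∈ᵇ ws

  certified-μ : ∀ K ws css → card n m (members ws) ≡ K → T (all (satisfiedᵇ (members ws)) allPairs) →
                T (scheduledᵇ allVertices css) → T (boundedᵇ K allVertices css ∅) → MuDTorusIs n m K
  certified-μ K ws css card-ws satisfied scheduled bounded =
    (members ws , all-satisfiedᵇ⇒IsDualMV (members ws) satisfied , card-ws) ,
    certified-upper-bound K css scheduled bounded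

  certified-μ≡0 : ∀ css → T (scheduledᵇ allVertices css) → T (boundedᵇ 0 allVertices css ∅) → MuDTorusIs n m 0
  certified-μ≡0 css scheduled bounded = (∅ , ∅-IsDualMV , card-∅) , certified-upper-bound 0 css scheduled bounded

private
  row-pattern-impossible : ∀ b₁ b₂ b₃ b₄ b₅ → b₃ ≡ true → b₂ ≢ b₄ → b₂ ≢ b₅ → b₄ ≢ b₁ →
                           (b₄ ≡ true → b₃ ≢ b₅) → (b₂ ≡ true → b₃ ≢ b₁) → ⊥
  row-pattern-impossible _     true  true true  _     refl b₂≢b₄ _     _     _ _ = b₂≢b₄ refl
  row-pattern-impossible true  true  true false _     refl _     _     _     _ E = E refl refl
  row-pattern-impossible false true  true false _     refl _     _     b₄≢b₁ _ _ = b₄≢b₁ refl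
  row-pattern-impossible _     false true false _     refl b₂≢b₄ _     _     _ _ = b₂≢b₄ refl
  row-pattern-impossible _     false true true  true  refl _     _     _     D _ = D refl refl
  row-pattern-impossible _     false true true  false refl _     b₂≢b₅ _     _ _ = b₂≢b₅ refl

module LongCycle (k l : ℕ) where

  open TorusGeometry (6 + k) l

  module _ {Y : Subset G} (dmv : IsDualMV G Y) where

    same-side⇒Visible : ∀ u v → Y u ≡ Y v → Visible G Y u v
    same-side⇒Visible u v same with Y u in Yu | Y v in Yv
    ... | true  | true  = proj₁ dmv u v Yu Yv
    ... | false | false = proj₂ dmv u v Yu Yv
    same-side⇒Visible u v () | true  | false
    same-side⇒Visible u v () | false | true

    blocker-separates : ∀ {u v x} → Y x ≡ true → 2 ≤ dist u v →
                        (∀ {w} → Adj G u w → dist w v < dist u v → w ≡ x) → Y u ≢ Y v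
    blocker-separates {u} {v} Yx 2≤dist only-x same with same-side⇒Visible u v same
    ... | p , shortest , avoids with p | shortest⇒len≡dist p shortest
    ...   | [] | len≡dist = contradiction (≤-trans 2≤dist (≤-reflexive (sym len≡dist))) λ ()
    ...   | _∷_ {w = w} adj q | len≡dist with only-x adj (≤-<-trans (dist≤len q) (≤-reflexive len≡dist))
    ...     | refl with avoids w (there (start∈verts q)) Yx
    ...       | inj₁ refl = <⇒≱ (≤-reflexive len≡dist) (dist≤len q)
    ...       | inj₂ refl = <⇒≱ 2≤dist (≤-trans (dist-Adj w adj) (s≤s (≤-reflexive (dist-self w))))

    module Row (y : Fin n) (j : Fin m) where

      r : ℕ → Vertex
      r s = next^ s y , j

      dist-row : ∀ s d → d < n → dist (r s) (r (s + d)) ≡ d ⊓ (n ∸ d)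
      dist-row s d d<n rewrite cdist-self j | +-identityʳ (cdist (next^ s y) (next^ (s + d) y)) | next^-+ s d y =
        cdist-next^ (next^ s y) d d<n

      closer-in-row : ∀ s t {w} → Adj G (r (suc s)) w → dist w (r t) < dist (r (suc s)) (r t) →
                      w ≡ r s ⊎ w ≡ r (suc (suc s))
      closer-in-row s t (inj₁ (refl , _)) closer rewrite cdist-self j =
        contradiction closer (≤⇒≯ (≤-trans (≤-reflexive (+-identityʳ _)) (m≤m+n _ _)))
      closer-in-row s t (inj₂ (refl , adj)) _ with CycAdj⇒next⊎prev adj
      ... | inj₁ refl = inj₂ (cong (_, j) (sym (next^-suc (suc s) y)))
      ... | inj₂ refl = inj₁ (cong (_, j) (trans (cong prev (next^-suc s y)) (prev-next (next^ s y))))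

      δ : ℕ → ℕ → ℕ
      δ s t = dist (r s) (r t)

      only-forward : ∀ s t → δ (suc s) t ≤ δ s t →
                     ∀ {w} → Adj G (r (suc s)) w → dist w (r t) < δ (suc s) t → w ≡ r (suc (suc s))
      only-forward s t no-back adj closer with closer-in-row s t adj closer
      ... | inj₁ refl = contradiction closer (≤⇒≯ no-back)
      ... | inj₂ w≡ = w≡

      only-backward : ∀ s t → δ (suc s) t ≤ δ (suc (suc s)) t →
                      ∀ {w} → Adj G (r (suc s)) w → dist w (r t) < δ (suc s) t → w ≡ r s
      only-backward s t no-forth adj closer with closer-in-row s t adj closer
      ... | inj₁ w≡ = w≡
      ... | inj₂ refl = contradiction closer (≤⇒≯ no-forth)

      private
        short : ∀ {d} → d ≤ 4 → d < n
        short d≤4 = s≤s (≤-trans d≤4 (m≤m+n 4 (2 + k)))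

      δ₁₃ : δ 1 3 ≡ 2
      δ₁₃ = dist-row 1 2 (short (s≤s (s≤s z≤n)))
      δ₁₄ : δ 1 4 ≡ 3
      δ₁₄ = dist-row 1 3 (short (s≤s (s≤s (s≤s z≤n))))
      3≤δ₁₅ : 3 ≤ δ 1 5
      3≤δ₁₅ = ≤-trans (s≤s (s≤s (s≤s z≤n))) (≤-reflexive (sym (dist-row 1 4 (short ≤-refl))))
      δ₂₄ : δ 2 4 ≡ 2
      δ₂₄ = dist-row 2 2 (short (s≤s (s≤s z≤n)))
      δ₂₅ : δ 2 5 ≡ 3
      δ₂₅ = dist-row 2 3 (short (s≤s (s≤s (s≤s z≤n))))
      δ₃₅ : δ 3 5 ≡ 2
      δ₃₅ = dist-row 3 2 (short (s≤s (s≤s z≤n)))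

      -- Inside Y, r₃ blocks r₂–r₄, r₂–r₅ and r₄–r₁, while r₄ blocks r₃–r₅ and r₂ blocks r₃–r₁.
      r₃∉Y : Y (r 3) ≢ true
      r₃∉Y Y₃ = row-pattern-impossible (Y (r 1)) (Y (r 2)) (Y (r 3)) (Y (r 4)) (Y (r 5)) Y₃
        (blocker-separates Y₃ (≤-reflexive (sym δ₂₄))
          (only-forward 1 4 (≤-trans (≤-reflexive δ₂₄) (≤-trans (n≤1+n 2) (≤-reflexive (sym δ₁₄))))))
        (blocker-separates Y₃ (≤-trans (n≤1+n 2) (≤-reflexive (sym δ₂₅)))
          (only-forward 1 5 (≤-trans (≤-reflexive δ₂₅) 3≤δ₁₅)))
        (blocker-separates Y₃ (≤-trans (n≤1+n 2) (≤-reflexive (sym δ₄₁)))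
          (only-backward 3 1 (≤-trans (≤-reflexive δ₄₁) (≤-trans 3≤δ₁₅ (≤-reflexive (dist-comm (r 1) (r 5)))))))
        (λ Y₄ → blocker-separates Y₄ (≤-reflexive (sym δ₃₅))
          (only-forward 2 5 (≤-trans (≤-reflexive δ₃₅) (≤-trans (n≤1+n 2) (≤-reflexive (sym δ₂₅))))))
        (λ Y₂ → blocker-separates Y₂ (≤-reflexive (sym δ₃₁))
          (only-backward 2 1 (≤-trans (≤-reflexive δ₃₁) (≤-trans (n≤1+n 2) (≤-reflexive (sym δ₄₁))))))
        where
        δ₄₁ : δ 4 1 ≡ 3
        δ₄₁ = trans (dist-comm (r 4) (r 1)) δ₁₄
        δ₃₁ : δ 3 1 ≡ 2
        δ₃₁ = trans (dist-comm (r 3) (r 1)) δ₁₃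

    long-cycle⇒empty : ∀ w → Y w ≡ false
    long-cycle⇒empty (i , j) with Y (i , j) in Yw
    ... | false = refl
    ... | true  = contradiction (subst (λ z → Y (z , j) ≡ true) (sym centre) Yw) (Row.r₃∉Y (next^ (4 + k) i) j)
      where
      centre : next^ 3 (next^ (4 + k) i) ≡ i
      centre = begin
        next^ 3 (next^ (4 + k) i)  ≡⟨ next^-+ (4 + k) 3 i ⟨
        next^ (4 + k + 3) i        ≡⟨ cong (λ s → next^ s i) (+-comm (4 + k) 3) ⟩
        next^ n i                  ≡⟨ next^-period i ⟩
        i                          ∎
        where open ≡-Reasoning

-- A schedule lists, for the k-th vertex of allVertices, the pairs tested once it is decided;
-- schedules and witnesses were found by computer search.
schedule-3-3 : List (List ((Fin 3 × Fin 3) × (Fin 3 × Fin 3)))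
schedule-3-3 = ([] ∷
     [] ∷
     [] ∷
     [] ∷
     (((# 0 , # 0) , (# 1 , # 1)) ∷ ((# 0 , # 1) , (# 1 , # 0)) ∷ []) ∷
     (((# 0 , # 0) , (# 1 , # 2)) ∷ ((# 0 , # 1) , (# 1 , # 2)) ∷ ((# 0 , # 2) , (# 1 , # 0)) ∷ ((# 0 , # 2) , (# 1 , # 1)) ∷ []) ∷
     [] ∷
     (((# 0 , # 0) , (# 2 , # 1)) ∷ ((# 1 , # 0) , (# 2 , # 1)) ∷ ((# 0 , # 1) , (# 2 , # 0)) ∷ ((# 1 , # 1) , (# 2 , # 0)) ∷ []) ∷
     (((# 0 , # 0) , (# 2 , # 2)) ∷ ((# 0 , # 1) , (# 2 , # 2)) ∷ ((# 1 , # 0) , (# 2 , # 2)) ∷ ((# 1 , # 1) , (# 2 , # 2)) ∷ ((# 0 , # 2) , (# 2 , # 0)) ∷ ((# 0 , # 2) , (# 2 , # 1)) ∷ ((# 1 , # 2) , (# 2 , # 0)) ∷ ((# 1 , # 2) , (# 2 , # 1)) ∷ []) ∷ [])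

witness-3-3 : List (Fin 3 × Fin 3)
witness-3-3 = (# 0 , # 0) ∷ (# 0 , # 1) ∷ (# 0 , # 2) ∷ (# 1 , # 0) ∷ (# 2 , # 0) ∷ []

μ-3-3 : MuDTorusIs 3 3 5
μ-3-3 = TorusSearch.certified-μ 2 2 5 witness-3-3 schedule-3-3 refl _ _ _

schedule-4-3 : List (List ((Fin 4 × Fin 3) × (Fin 4 × Fin 3)))
schedule-4-3 = ([] ∷
     [] ∷
     [] ∷
     [] ∷
     (((# 0 , # 0) , (# 1 , # 1)) ∷ ((# 0 , # 1) , (# 1 , # 0)) ∷ []) ∷
     (((# 0 , # 0) , (# 1 , # 2)) ∷ ((# 0 , # 1) , (# 1 , # 2)) ∷ ((# 0 , # 2) , (# 1 , # 0)) ∷ ((# 0 , # 2) , (# 1 , # 1)) ∷ []) ∷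
     [] ∷
     (((# 1 , # 0) , (# 2 , # 1)) ∷ ((# 1 , # 1) , (# 2 , # 0)) ∷ []) ∷
     (((# 1 , # 0) , (# 2 , # 2)) ∷ ((# 1 , # 1) , (# 2 , # 2)) ∷ ((# 1 , # 2) , (# 2 , # 0)) ∷ ((# 1 , # 2) , (# 2 , # 1)) ∷ []) ∷
     (((# 0 , # 0) , (# 2 , # 0)) ∷ ((# 1 , # 0) , (# 3 , # 0)) ∷ []) ∷
     (((# 0 , # 0) , (# 3 , # 1)) ∷ ((# 0 , # 1) , (# 2 , # 1)) ∷ ((# 2 , # 0) , (# 3 , # 1)) ∷ ((# 0 , # 0) , (# 2 , # 1)) ∷ ((# 0 , # 1) , (# 3 , # 0)) ∷ ((# 1 , # 1) , (# 3 , # 1)) ∷ ((# 2 , # 1) , (# 3 , # 0)) ∷ ((# 1 , # 0) , (# 3 , # 1)) ∷ ((# 0 , # 1) , (# 2 , # 0)) ∷ ((# 1 , # 1) , (# 3 , # 0)) ∷ []) ∷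
     (((# 0 , # 0) , (# 3 , # 2)) ∷ ((# 0 , # 1) , (# 3 , # 2)) ∷ ((# 0 , # 2) , (# 2 , # 2)) ∷ ((# 2 , # 0) , (# 3 , # 2)) ∷ ((# 0 , # 0) , (# 2 , # 2)) ∷ ((# 2 , # 1) , (# 3 , # 2)) ∷ ((# 0 , # 1) , (# 2 , # 2)) ∷ ((# 0 , # 2) , (# 3 , # 0)) ∷ ((# 0 , # 2) , (# 3 , # 1)) ∷ ((# 2 , # 2) , (# 3 , # 0)) ∷ ((# 0 , # 2) , (# 2 , # 0)) ∷ ((# 0 , # 2) , (# 2 , # 1)) ∷ ((# 2 , # 2) , (# 3 , # 1)) ∷ ((# 1 , # 2) , (# 3 , # 2)) ∷ ((# 1 , # 0) , (# 3 , # 2)) ∷ ((# 1 , # 1) , (# 3 , # 2)) ∷ ((# 1 , # 2) , (# 3 , # 0)) ∷ ((# 1 , # 2) , (# 3 , # 1)) ∷ []) ∷ [])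

witness-4-3 : List (Fin 4 × Fin 3)
witness-4-3 = (# 0 , # 0) ∷ (# 0 , # 1) ∷ (# 0 , # 2) ∷ (# 1 , # 0) ∷ (# 2 , # 0) ∷ []

μ-4-3 : MuDTorusIs 4 3 5
μ-4-3 = TorusSearch.certified-μ 3 2 5 witness-4-3 schedule-4-3 refl _ _ _

schedule-4-4 : List (List ((Fin 4 × Fin 4) × (Fin 4 × Fin 4)))
schedule-4-4 = ([] ∷
     [] ∷
     [] ∷
     (((# 0 , # 0) , (# 0 , # 2)) ∷ ((# 0 , # 1) , (# 0 , # 3)) ∷ []) ∷
     [] ∷
     (((# 0 , # 0) , (# 1 , # 1)) ∷ ((# 0 , # 1) , (# 1 , # 0)) ∷ []) ∷
     (((# 0 , # 1) , (# 1 , # 2)) ∷ ((# 0 , # 2) , (# 1 , # 1)) ∷ []) ∷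
     (((# 0 , # 0) , (# 1 , # 3)) ∷ ((# 0 , # 0) , (# 1 , # 2)) ∷ ((# 0 , # 2) , (# 1 , # 3)) ∷ ((# 1 , # 0) , (# 1 , # 2)) ∷ ((# 0 , # 3) , (# 1 , # 0)) ∷ ((# 0 , # 1) , (# 1 , # 3)) ∷ ((# 0 , # 2) , (# 1 , # 0)) ∷ ((# 0 , # 3) , (# 1 , # 2)) ∷ ((# 1 , # 1) , (# 1 , # 3)) ∷ ((# 0 , # 3) , (# 1 , # 1)) ∷ []) ∷
     [] ∷
     (((# 1 , # 0) , (# 2 , # 1)) ∷ ((# 1 , # 1) , (# 2 , # 0)) ∷ []) ∷
     (((# 1 , # 1) , (# 2 , # 2)) ∷ ((# 1 , # 2) , (# 2 , # 1)) ∷ []) ∷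
     (((# 1 , # 0) , (# 2 , # 3)) ∷ ((# 2 , # 0) , (# 2 , # 2)) ∷ ((# 1 , # 2) , (# 2 , # 3)) ∷ ((# 1 , # 0) , (# 2 , # 2)) ∷ ((# 1 , # 3) , (# 2 , # 0)) ∷ ((# 2 , # 1) , (# 2 , # 3)) ∷ ((# 1 , # 3) , (# 2 , # 2)) ∷ ((# 1 , # 1) , (# 2 , # 3)) ∷ ((# 1 , # 2) , (# 2 , # 0)) ∷ ((# 1 , # 3) , (# 2 , # 1)) ∷ []) ∷
     (((# 0 , # 0) , (# 2 , # 0)) ∷ ((# 1 , # 0) , (# 3 , # 0)) ∷ []) ∷
     (((# 0 , # 0) , (# 3 , # 1)) ∷ ((# 2 , # 0) , (# 3 , # 1)) ∷ ((# 0 , # 1) , (# 2 , # 1)) ∷ ((# 0 , # 1) , (# 3 , # 0)) ∷ ((# 0 , # 0) , (# 2 , # 1)) ∷ ((# 2 , # 1) , (# 3 , # 0)) ∷ ((# 1 , # 1) , (# 3 , # 1)) ∷ ((# 1 , # 0) , (# 3 , # 1)) ∷ ((# 0 , # 1) , (# 2 , # 0)) ∷ ((# 1 , # 1) , (# 3 , # 0)) ∷ []) ∷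
     (((# 0 , # 1) , (# 3 , # 2)) ∷ ((# 0 , # 2) , (# 2 , # 2)) ∷ ((# 2 , # 1) , (# 3 , # 2)) ∷ ((# 0 , # 2) , (# 3 , # 1)) ∷ ((# 0 , # 1) , (# 2 , # 2)) ∷ ((# 2 , # 2) , (# 3 , # 1)) ∷ ((# 1 , # 2) , (# 3 , # 2)) ∷ ((# 1 , # 1) , (# 3 , # 2)) ∷ ((# 0 , # 2) , (# 2 , # 1)) ∷ ((# 1 , # 2) , (# 3 , # 1)) ∷ []) ∷
     (((# 0 , # 0) , (# 3 , # 3)) ∷ ((# 0 , # 2) , (# 3 , # 3)) ∷ ((# 0 , # 3) , (# 2 , # 3)) ∷ ((# 0 , # 0) , (# 2 , # 3)) ∷ ((# 2 , # 0) , (# 3 , # 3)) ∷ ((# 0 , # 0) , (# 3 , # 2)) ∷ ((# 0 , # 2) , (# 2 , # 3)) ∷ ((# 0 , # 3) , (# 3 , # 0)) ∷ ((# 2 , # 2) , (# 3 , # 3)) ∷ ((# 2 , # 0) , (# 3 , # 2)) ∷ ((# 3 , # 0) , (# 3 , # 2)) ∷ ((# 0 , # 3) , (# 3 , # 2)) ∷ ((# 0 , # 1) , (# 3 , # 3)) ∷ ((# 2 , # 3) , (# 3 , # 0)) ∷ ((# 0 , # 2) , (# 3 , # 0)) ∷ ((# 0 , # 3) , (# 2 , # 0)) ∷ ((# 0 , # 3) , (# 2 , # 2)) ∷ ((# 1 , # 3) , (# 3 , # 3)) ∷ ((# 2 , # 3) , (# 3 , # 2)) ∷ ((# 3 ,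 # 1) , (# 3 , # 3)) ∷ ((# 2 , # 2) , (# 3 , # 0)) ∷ ((# 2 , # 1) , (# 3 , # 3)) ∷ ((# 1 , # 0) , (# 3 , # 3)) ∷ ((# 1 , # 2) , (# 3 , # 3)) ∷ ((# 0 , # 3) , (# 3 , # 1)) ∷ ((# 1 , # 3) , (# 3 , # 0)) ∷ ((# 1 , # 3) , (# 3 , # 2)) ∷ ((# 2 , # 3) , (# 3 , # 1)) ∷ ((# 0 , # 1) , (# 2 , # 3)) ∷ ((# 0 , # 0) , (# 2 , # 2)) ∷ ((# 0 , # 2) , (# 2 , # 0)) ∷ ((# 0 , # 3) , (# 2 , # 1)) ∷ ((# 1 , # 0) , (# 3 , # 2)) ∷ ((# 1 , # 2) , (# 3 , # 0)) ∷ ((# 1 , # 1) , (# 3 , # 3)) ∷ ((# 1 , # 3) , (# 3 , # 1)) ∷ []) ∷ [])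

witness-4-4 : List (Fin 4 × Fin 4)
witness-4-4 = (# 0 , # 0) ∷ (# 0 , # 2) ∷ (# 0 , # 3) ∷ (# 1 , # 2) ∷ (# 2 , # 0) ∷ (# 2 , # 1) ∷ (# 2 , # 2) ∷ (# 3 , # 0) ∷ []

μ-4-4 : MuDTorusIs 4 4 8
μ-4-4 = TorusSearch.certified-μ 3 3 8 witness-4-4 schedule-4-4 refl _ _ _

schedule-5-3 : List (List ((Fin 5 × Fin 3) × (Fin 5 × Fin 3)))
schedule-5-3 = ([] ∷
     [] ∷
     [] ∷
     [] ∷
     (((# 0 , # 0) , (# 1 , # 1)) ∷ ((# 0 , # 1) , (# 1 , # 0)) ∷ []) ∷
     (((# 0 , # 0) , (# 1 , # 2)) ∷ ((# 0 , # 1) , (# 1 , # 2)) ∷ ((# 0 , # 2) , (# 1 , # 0)) ∷ ((# 0 , # 2) , (# 1 , # 1)) ∷ []) ∷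
     (((# 0 , # 0) , (# 2 , # 0)) ∷ []) ∷
     (((# 0 , # 0) , (# 2 , # 1)) ∷ ((# 0 , # 1) , (# 2 , # 1)) ∷ ((# 0 , # 1) , (# 2 , # 0)) ∷ ((# 1 , # 0) , (# 2 , # 1)) ∷ []) ∷
     (((# 0 , # 0) , (# 2 , # 2)) ∷ ((# 0 , # 1) , (# 2 , # 2)) ∷ ((# 0 , # 2) , (# 2 , # 2)) ∷ ((# 0 , # 2) , (# 2 , # 0)) ∷ ((# 0 , # 2) , (# 2 , # 1)) ∷ ((# 1 , # 0) , (# 2 , # 2)) ∷ ((# 1 , # 1) , (# 2 , # 2)) ∷ []) ∷
     (((# 1 , # 0) , (# 3 , # 0)) ∷ []) ∷
     (((# 1 , # 0) , (# 3 , # 1)) ∷ ((# 1 , # 1) , (# 3 , # 1)) ∷ ((# 2 , # 0) , (# 3 , # 1)) ∷ ((# 1 , # 1) , (# 3 , # 0)) ∷ []) ∷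
     (((# 1 , # 0) , (# 3 , # 2)) ∷ ((# 1 , # 1) , (# 3 , # 2)) ∷ ((# 2 , # 0) , (# 3 , # 2)) ∷ ((# 2 , # 1) , (# 3 , # 2)) ∷ ((# 1 , # 2) , (# 3 , # 2)) ∷ ((# 1 , # 2) , (# 3 , # 0)) ∷ ((# 1 , # 2) , (# 3 , # 1)) ∷ []) ∷
     (((# 0 , # 0) , (# 3 , # 0)) ∷ ((# 1 , # 0) , (# 4 , # 0)) ∷ ((# 2 , # 0) , (# 4 , # 0)) ∷ []) ∷
     (((# 0 , # 0) , (# 3 , # 1)) ∷ ((# 0 , # 1) , (# 3 , # 0)) ∷ ((# 0 , # 1) , (# 3 , # 1)) ∷ ((# 1 , # 1) , (# 4 , # 1)) ∷ ((# 0 , # 0) , (# 4 , # 1)) ∷ ((# 2 , # 1) , (# 4 , # 1)) ∷ ((# 1 , # 0) , (# 4 , # 1)) ∷ ((# 2 , # 0) , (# 4 , # 1)) ∷ ((# 1 , # 1) , (# 4 , # 0)) ∷ ((# 2 , # 1) , (# 4 , # 0)) ∷ ((# 3 , # 0) , (# 4 , # 1)) ∷ []) ∷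
     (((# 0 , # 0) , (# 3 , # 2)) ∷ ((# 0 , # 1) , (# 3 , # 2)) ∷ ((# 0 , # 2) , (# 3 , # 2)) ∷ ((# 0 , # 2) , (# 3 , # 0)) ∷ ((# 0 , # 2) , (# 3 , # 1)) ∷ ((# 1 , # 2) , (# 4 , # 2)) ∷ ((# 0 , # 0) , (# 4 , # 2)) ∷ ((# 0 , # 1) , (# 4 , # 2)) ∷ ((# 2 , # 2) , (# 4 , # 2)) ∷ ((# 1 , # 0) , (# 4 , # 2)) ∷ ((# 1 , # 1) , (# 4 , # 2)) ∷ ((# 2 , # 0) , (# 4 , # 2)) ∷ ((# 2 , # 1) , (# 4 , # 2)) ∷ ((# 1 , # 2) , (# 4 , # 0)) ∷ ((# 1 , # 2) , (# 4 , # 1)) ∷ ((# 2 , # 2) , (# 4 , # 0)) ∷ ((# 2 , # 2) , (# 4 , # 1)) ∷ ((# 3 , # 0) , (# 4 , # 2)) ∷ ((# 3 , # 1) , (# 4 , # 2)) ∷ []) ∷ [])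

witness-5-3 : List (Fin 5 × Fin 3)
witness-5-3 = (# 0 , # 0) ∷ (# 1 , # 0) ∷ []

μ-5-3 : MuDTorusIs 5 3 2
μ-5-3 = TorusSearch.certified-μ 4 2 2 witness-5-3 schedule-5-3 refl _ _ _

schedule-5-4 : List (List ((Fin 5 × Fin 4) × (Fin 5 × Fin 4)))
schedule-5-4 = ([] ∷
     [] ∷
     [] ∷
     (((# 0 , # 0) , (# 0 , # 2)) ∷ ((# 0 , # 1) , (# 0 , # 3)) ∷ []) ∷
     [] ∷
     (((# 0 , # 0) , (# 1 , # 1)) ∷ ((# 0 , # 1) , (# 1 , # 0)) ∷ []) ∷
     (((# 0 , # 1) , (# 1 , # 2)) ∷ ((# 0 , # 2) , (# 1 , # 1)) ∷ []) ∷
     (((# 0 , # 0) , (# 1 , # 3)) ∷ ((# 0 , # 0) , (# 1 , # 2)) ∷ ((# 0 , # 2) , (# 1 , # 3)) ∷ ((# 1 , # 0) , (# 1 , # 2)) ∷ ((# 0 , # 3) , (# 1 , # 0)) ∷ ((# 0 , # 1) , (# 1 , # 3)) ∷ ((# 0 , # 2) , (# 1 , # 0)) ∷ ((# 0 , # 3) , (# 1 , # 2)) ∷ ((# 1 , # 1) , (# 1 , # 3)) ∷ ((# 0 , # 3) , (# 1 , # 1)) ∷ []) ∷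
     (((# 0 , # 0) , (# 2 , # 0)) ∷ []) ∷
     (((# 0 , # 0) , (# 2 , # 1)) ∷ ((# 0 , # 1) , (# 2 , # 1)) ∷ ((# 0 , # 1) , (# 2 , # 0)) ∷ ((# 1 , # 0) , (# 2 , # 1)) ∷ []) ∷
     (((# 0 , # 1) , (# 2 , # 2)) ∷ ((# 0 , # 2) , (# 2 , # 2)) ∷ ((# 0 , # 2) , (# 2 , # 1)) ∷ ((# 1 , # 1) , (# 2 , # 2)) ∷ []) ∷
     (((# 0 , # 0) , (# 2 , # 3)) ∷ ((# 0 , # 2) , (# 2 , # 3)) ∷ ((# 2 , # 0) , (# 2 , # 2)) ∷ ((# 0 , # 3) , (# 2 , # 3)) ∷ ((# 0 , # 3) , (# 2 , # 0)) ∷ ((# 0 , # 3) , (# 2 , # 2)) ∷ ((# 2 , # 1) , (# 2 , # 3)) ∷ ((# 0 , # 1) , (# 2 , # 3)) ∷ ((# 0 , # 0) , (# 2 , # 2)) ∷ ((# 0 , # 2) , (# 2 , # 0)) ∷ ((# 0 , # 3) , (# 2 , # 1)) ∷ ((# 1 , # 0) , (# 2 , # 3)) ∷ ((# 1 , # 2) , (# 2 , # 3)) ∷ ((# 1 , # 0) , (# 2 , # 2)) ∷ []) ∷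
     (((# 1 , # 0) , (# 3 , # 0)) ∷ []) ∷
     (((# 1 , # 0) , (# 3 , # 1)) ∷ ((# 1 , # 1) , (# 3 , # 1)) ∷ ((# 2 , # 0) , (# 3 , # 1)) ∷ ((# 1 , # 1) , (# 3 , # 0)) ∷ []) ∷
     (((# 1 , # 1) , (# 3 , # 2)) ∷ ((# 1 , # 2) , (# 3 , # 2)) ∷ ((# 2 , # 1) , (# 3 , # 2)) ∷ ((# 1 , # 2) , (# 3 , # 1)) ∷ []) ∷
     (((# 1 , # 0) , (# 3 , # 3)) ∷ ((# 3 , # 0) , (# 3 , # 2)) ∷ ((# 1 , # 2) , (# 3 , # 3)) ∷ ((# 3 , # 1) , (# 3 , # 3)) ∷ ((# 2 , # 0) , (# 3 , # 3)) ∷ ((# 1 , # 3) , (# 3 , # 3)) ∷ ((# 2 , # 2) , (# 3 , # 3)) ∷ ((# 1 , # 3) , (# 3 , # 0)) ∷ ((# 1 , # 3) , (# 3 , # 2)) ∷ ((# 2 , # 0) , (# 3 , # 2)) ∷ ((# 1 , # 0) , (# 3 , # 2)) ∷ ((# 1 , # 1) , (# 3 , # 3)) ∷ ((# 1 , # 2) , (# 3 , # 0)) ∷ ((# 1 , # 3) , (# 3 , # 1)) ∷ []) ∷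
     (((# 0 , # 0) , (# 3 , # 0)) ∷ ((# 1 , # 0) , (# 4 , # 0)) ∷ ((# 2 , # 0) , (# 4 , # 0)) ∷ []) ∷
     (((# 0 , # 0) , (# 3 , # 1)) ∷ ((# 0 , # 1) , (# 3 , # 0)) ∷ ((# 0 , # 1) , (# 3 , # 1)) ∷ ((# 1 , # 1) , (# 4 , # 1)) ∷ ((# 0 , # 0) , (# 4 , # 1)) ∷ ((# 2 , # 1) , (# 4 , # 1)) ∷ ((# 1 , # 0) , (# 4 , # 1)) ∷ ((# 2 , # 0) , (# 4 , # 1)) ∷ ((# 2 , # 1) , (# 4 , # 0)) ∷ ((# 3 , # 0) , (# 4 , # 1)) ∷ ((# 1 , # 1) , (# 4 , # 0)) ∷ []) ∷
     (((# 0 , # 2) , (# 3 , # 2)) ∷ ((# 1 , # 2) , (# 4 , # 2)) ∷ ((# 0 , # 1) , (# 3 , # 2)) ∷ ((# 2 , # 2) , (# 4 , # 2)) ∷ ((# 0 , # 2) , (# 3 , # 1)) ∷ ((# 0 , # 1) , (# 4 , # 2)) ∷ ((# 1 , # 1) , (# 4 , # 2)) ∷ ((# 2 , # 1) , (# 4 , # 2)) ∷ ((# 1 , # 2) , (# 4 , # 1)) ∷ ((# 2 , # 2) , (# 4 , # 1)) ∷ ((# 3 , # 1) , (# 4 , # 2)) ∷ []) ∷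
     (((# 0 , # 0) , (# 3 , # 3)) ∷ ((# 0 , # 2) , (# 3 , # 3)) ∷ ((# 0 , # 3) , (# 3 , # 3)) ∷ ((# 0 , # 0) , (# 4 , # 3)) ∷ ((# 0 , # 3) , (# 3 , # 0)) ∷ ((# 0 , # 3) , (# 3 , # 2)) ∷ ((# 1 , # 3) , (# 4 , # 3)) ∷ ((# 2 , # 3) , (# 4 , # 3)) ∷ ((# 0 , # 2) , (# 4 , # 3)) ∷ ((# 2 , # 0) , (# 4 , # 3)) ∷ ((# 2 , # 2) , (# 4 , # 3)) ∷ ((# 1 , # 0) , (# 4 , # 3)) ∷ ((# 1 , # 2) , (# 4 , # 3)) ∷ ((# 0 , # 1) , (# 4 , # 3)) ∷ ((# 1 , # 3) , (# 4 , # 0)) ∷ ((# 1 , # 3) , (# 4 , # 2)) ∷ ((# 2 , # 3) , (# 4 , # 0)) ∷ ((# 2 , # 3) , (# 4 , # 2)) ∷ ((# 3 , # 0) , (# 4 , # 3)) ∷ ((# 4 , # 0) , (# 4 , # 2)) ∷ ((# 4 , # 1) , (# 4 , # 3)) ∷ ((# 3 , # 2) , (# 4 , # 3)) ∷ []) ∷ [])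

witness-5-4 : List (Fin 5 × Fin 4)
witness-5-4 = (# 0 , # 2) ∷ (# 1 , # 2) ∷ (# 2 , # 0) ∷ (# 3 , # 0) ∷ []

μ-5-4 : MuDTorusIs 5 4 4
μ-5-4 = TorusSearch.certified-μ 4 3 4 witness-5-4 schedule-5-4 refl _ _ _

schedule-6-3 : List (List ((Fin 6 × Fin 3) × (Fin 6 × Fin 3)))
schedule-6-3 = ([] ∷
     [] ∷
     [] ∷
     [] ∷
     (((# 0 , # 0) , (# 1 , # 1)) ∷ ((# 0 , # 1) , (# 1 , # 0)) ∷ []) ∷
     (((# 0 , # 0) , (# 1 , # 2)) ∷ ((# 0 , # 1) , (# 1 , # 2)) ∷ ((# 0 , # 2) , (# 1 , # 0)) ∷ ((# 0 , # 2) , (# 1 , # 1)) ∷ []) ∷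
     (((# 0 , # 0) , (# 2 , # 0)) ∷ []) ∷
     (((# 0 , # 0) , (# 2 , # 1)) ∷ ((# 0 , # 1) , (# 2 , # 1)) ∷ ((# 0 , # 1) , (# 2 , # 0)) ∷ ((# 1 , # 0) , (# 2 , # 1)) ∷ []) ∷
     (((# 0 , # 0) , (# 2 , # 2)) ∷ ((# 0 , # 1) , (# 2 , # 2)) ∷ ((# 0 , # 2) , (# 2 , # 2)) ∷ ((# 0 , # 2) , (# 2 , # 0)) ∷ ((# 0 , # 2) , (# 2 , # 1)) ∷ ((# 1 , # 0) , (# 2 , # 2)) ∷ ((# 1 , # 1) , (# 2 , # 2)) ∷ []) ∷
     (((# 1 , # 0) , (# 3 , # 0)) ∷ []) ∷
     (((# 1 , # 0) , (# 3 , # 1)) ∷ ((# 1 , # 1) , (# 3 , # 1)) ∷ ((# 2 , # 0) , (# 3 , # 1)) ∷ ((# 1 , # 1) , (# 3 , # 0)) ∷ []) ∷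
     (((# 1 , # 0) , (# 3 , # 2)) ∷ ((# 1 , # 1) , (# 3 , # 2)) ∷ ((# 2 , # 0) , (# 3 , # 2)) ∷ ((# 2 , # 1) , (# 3 , # 2)) ∷ ((# 1 , # 2) , (# 3 , # 2)) ∷ ((# 1 , # 2) , (# 3 , # 0)) ∷ ((# 1 , # 2) , (# 3 , # 1)) ∷ []) ∷
     (((# 2 , # 0) , (# 4 , # 0)) ∷ []) ∷
     (((# 2 , # 0) , (# 4 , # 1)) ∷ ((# 2 , # 1) , (# 4 , # 1)) ∷ ((# 2 , # 1) , (# 4 , # 0)) ∷ ((# 3 , # 0) , (# 4 , # 1)) ∷ []) ∷
     (((# 2 , # 0) , (# 4 , # 2)) ∷ ((# 2 , # 1) , (# 4 , # 2)) ∷ ((# 2 , # 2) , (# 4 , # 2)) ∷ ((# 3 , # 0) , (# 4 , # 2)) ∷ ((# 3 , # 1) , (# 4 , # 2)) ∷ ((# 2 , # 2) , (# 4 , # 0)) ∷ ((# 2 , # 2) , (# 4 , # 1)) ∷ []) ∷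
     (((# 0 , # 0) , (# 4 , # 0)) ∷ ((# 1 , # 0) , (# 5 , # 0)) ∷ ((# 3 , # 0) , (# 5 , # 0)) ∷ ((# 0 , # 0) , (# 3 , # 0)) ∷ ((# 2 , # 0) , (# 5 , # 0)) ∷ ((# 1 , # 0) , (# 4 , # 0)) ∷ []) ∷
     (((# 0 , # 0) , (# 4 , # 1)) ∷ ((# 0 , # 1) , (# 4 , # 0)) ∷ ((# 0 , # 1) , (# 4 , # 1)) ∷ ((# 1 , # 1) , (# 5 , # 1)) ∷ ((# 0 , # 0) , (# 5 , # 1)) ∷ ((# 1 , # 0) , (# 5 , # 1)) ∷ ((# 3 , # 1) , (# 5 , # 1)) ∷ ((# 0 , # 1) , (# 3 , # 1)) ∷ ((# 3 , # 0) , (# 5 , # 1)) ∷ ((# 1 , # 1) , (# 5 , # 0)) ∷ ((# 3 , # 1) , (# 5 , # 0)) ∷ ((# 4 , # 0) , (# 5 , # 1)) ∷ ((# 2 , # 1) , (# 5 , # 1)) ∷ ((# 1 , # 1) , (# 4 , # 1)) ∷ []) ∷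
     (((# 0 , # 0) , (# 4 , # 2)) ∷ ((# 0 , # 1) , (# 4 , # 2)) ∷ ((# 0 , # 2) , (# 4 , # 2)) ∷ ((# 0 , # 2) , (# 3 , # 2)) ∷ ((# 0 , # 2) , (# 4 , # 0)) ∷ ((# 0 , # 2) , (# 4 , # 1)) ∷ ((# 1 , # 2) , (# 5 , # 2)) ∷ ((# 0 , # 0) , (# 5 , # 2)) ∷ ((# 0 , # 1) , (# 5 , # 2)) ∷ ((# 3 , # 2) , (# 5 , # 2)) ∷ ((# 1 , # 0) , (# 5 , # 2)) ∷ ((# 1 , # 1) , (# 5 , # 2)) ∷ ((# 1 , # 2) , (# 5 , # 0)) ∷ ((# 1 , # 2) , (# 5 , # 1)) ∷ ((# 3 , # 0) , (# 5 , # 2)) ∷ ((# 3 , # 1) , (# 5 , # 2)) ∷ ((# 2 , # 2) , (# 5 , # 2)) ∷ ((# 3 , # 2) , (# 5 , # 0)) ∷ ((# 3 , # 2) , (# 5 , # 1)) ∷ ((# 4 , # 0) , (# 5 , # 2)) ∷ ((# 4 , # 1) , (# 5 , # 2)) ∷ ((# 1 , # 2) , (# 4 , # 2)) ∷ []) ∷ [])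

witness-6-3 : List (Fin 6 × Fin 3)
witness-6-3 = (# 0 , # 1) ∷ (# 1 , # 1) ∷ (# 3 , # 0) ∷ (# 4 , # 0) ∷ []

μ-6-3 : MuDTorusIs 6 3 4
μ-6-3 = TorusSearch.certified-μ 5 2 4 witness-6-3 schedule-6-3 refl _ _ _

schedule-6-4 : List (List ((Fin 6 × Fin 4) × (Fin 6 × Fin 4)))
schedule-6-4 = ([] ∷
     [] ∷
     [] ∷
     (((# 0 , # 0) , (# 0 , # 2)) ∷ ((# 0 , # 1) , (# 0 , # 3)) ∷ []) ∷
     [] ∷
     (((# 0 , # 0) , (# 1 , # 1)) ∷ ((# 0 , # 1) , (# 1 , # 0)) ∷ []) ∷
     (((# 0 , # 1) , (# 1 , # 2)) ∷ ((# 0 , # 2) , (# 1 , # 1)) ∷ []) ∷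
     (((# 0 , # 0) , (# 1 , # 3)) ∷ ((# 0 , # 0) , (# 1 , # 2)) ∷ ((# 0 , # 2) , (# 1 , # 3)) ∷ ((# 1 , # 0) , (# 1 , # 2)) ∷ ((# 0 , # 3) , (# 1 , # 0)) ∷ ((# 0 , # 1) , (# 1 , # 3)) ∷ ((# 0 , # 2) , (# 1 , # 0)) ∷ ((# 0 , # 3) , (# 1 , # 2)) ∷ ((# 1 , # 1) , (# 1 , # 3)) ∷ ((# 0 , # 3) , (# 1 , # 1)) ∷ []) ∷
     (((# 0 , # 0) , (# 2 , # 0)) ∷ []) ∷
     (((# 0 , # 0) , (# 2 , # 1)) ∷ ((# 0 , # 1) , (# 2 , # 1)) ∷ ((# 0 , # 1) , (# 2 , # 0)) ∷ ((# 1 , # 0) , (# 2 , # 1)) ∷ []) ∷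
     (((# 0 , # 1) , (# 2 , # 2)) ∷ ((# 0 , # 2) , (# 2 , # 2)) ∷ ((# 0 , # 2) , (# 2 , # 1)) ∷ ((# 1 , # 1) , (# 2 , # 2)) ∷ []) ∷
     (((# 0 , # 0) , (# 2 , # 3)) ∷ ((# 0 , # 2) , (# 2 , # 3)) ∷ ((# 2 , # 0) , (# 2 , # 2)) ∷ ((# 0 , # 3) , (# 2 , # 3)) ∷ ((# 0 , # 3) , (# 2 , # 0)) ∷ ((# 0 , # 3) , (# 2 , # 2)) ∷ ((# 2 , # 1) , (# 2 , # 3)) ∷ ((# 0 , # 1) , (# 2 , # 3)) ∷ ((# 0 , # 0) , (# 2 , # 2)) ∷ ((# 0 , # 2) , (# 2 , # 0)) ∷ ((# 0 , # 3) , (# 2 , # 1)) ∷ ((# 1 , # 0) , (# 2 , # 3)) ∷ ((# 1 , # 2) , (# 2 , # 3)) ∷ ((# 1 , # 0) , (# 2 , # 2)) ∷ []) ∷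
     (((# 1 , # 0) , (# 3 , # 0)) ∷ []) ∷
     (((# 1 , # 0) , (# 3 , # 1)) ∷ ((# 1 , # 1) , (# 3 , # 1)) ∷ ((# 2 , # 0) , (# 3 , # 1)) ∷ ((# 1 , # 1) , (# 3 , # 0)) ∷ []) ∷
     (((# 1 , # 1) , (# 3 , # 2)) ∷ ((# 1 , # 2) , (# 3 , # 2)) ∷ ((# 2 , # 1) , (# 3 , # 2)) ∷ ((# 1 , # 2) , (# 3 , # 1)) ∷ []) ∷
     (((# 1 , # 0) , (# 3 , # 3)) ∷ ((# 3 , # 0) , (# 3 , # 2)) ∷ ((# 1 , # 2) , (# 3 , # 3)) ∷ ((# 3 , # 1) , (# 3 , # 3)) ∷ ((# 2 , # 0) , (# 3 , # 3)) ∷ ((# 1 , # 3) , (# 3 , # 3)) ∷ ((# 2 , # 2) , (# 3 , # 3)) ∷ ((# 1 , # 3) , (# 3 , # 0)) ∷ ((# 1 , # 3) , (# 3 , # 2)) ∷ ((# 2 , # 0) , (# 3 , # 2)) ∷ ((# 1 , # 0) , (# 3 , # 2)) ∷ ((# 1 , # 1) , (# 3 , # 3)) ∷ ((# 1 , # 2) , (# 3 , # 0)) ∷ ((# 1 , # 3) , (# 3 , # 1)) ∷ []) ∷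
     (((# 2 , # 0) , (# 4 , # 0)) ∷ []) ∷
     (((# 2 , # 0) , (# 4 , # 1)) ∷ ((# 2 , # 1) , (# 4 , # 1)) ∷ ((# 2 , # 1) , (# 4 , # 0)) ∷ ((# 3 , # 0) , (# 4 , # 1)) ∷ []) ∷
     (((# 2 , # 1) , (# 4 , # 2)) ∷ ((# 2 , # 2) , (# 4 , # 2)) ∷ ((# 3 , # 1) , (# 4 , # 2)) ∷ ((# 2 , # 2) , (# 4 , # 1)) ∷ []) ∷
     (((# 2 , # 0) , (# 4 , # 3)) ∷ ((# 4 , # 0) , (# 4 , # 2)) ∷ ((# 2 , # 2) , (# 4 , # 3)) ∷ ((# 2 , # 3) , (# 4 , # 3)) ∷ ((# 3 , # 0) , (# 4 , # 3)) ∷ ((# 2 , # 3) , (# 4 , # 0)) ∷ ((# 3 , # 2) , (# 4 , # 3)) ∷ ((# 2 , # 3) , (# 4 , # 2)) ∷ ((# 4 , # 1) , (# 4 , # 3)) ∷ ((# 3 , # 0) , (# 4 , # 2)) ∷ ((# 2 , # 0) , (# 4 , # 2)) ∷ ((# 2 , # 1) , (# 4 , # 3)) ∷ ((# 2 , # 2) , (# 4 , # 0)) ∷ ((# 2 , # 3) , (# 4 , # 1)) ∷ []) ∷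
     (((# 0 , # 0) , (# 4 , # 0)) ∷ ((# 1 , # 0) , (# 5 , # 0)) ∷ ((# 3 , # 0) , (# 5 , # 0)) ∷ ((# 0 , # 0) , (# 3 , # 0)) ∷ ((# 2 , # 0) , (# 5 , # 0)) ∷ ((# 1 , # 0) , (# 4 , # 0)) ∷ []) ∷
     (((# 0 , # 0) , (# 4 , # 1)) ∷ ((# 0 , # 1) , (# 4 , # 1)) ∷ ((# 0 , # 1) , (# 4 , # 0)) ∷ ((# 1 , # 1) , (# 5 , # 1)) ∷ ((# 0 , # 0) , (# 5 , # 1)) ∷ ((# 3 , # 1) , (# 5 , # 1)) ∷ ((# 1 , # 0) , (# 5 , # 1)) ∷ ((# 3 , # 0) , (# 5 , # 1)) ∷ ((# 0 , # 1) , (# 3 , # 1)) ∷ ((# 1 , # 1) , (# 5 , # 0)) ∷ ((# 3 , # 1) , (# 5 , # 0)) ∷ ((# 4 , # 0) , (# 5 , # 1)) ∷ ((# 2 , # 1) , (# 5 , # 1)) ∷ ((# 1 , # 1) , (# 4 , # 1)) ∷ []) ∷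
     (((# 0 , # 2) , (# 4 , # 2)) ∷ ((# 1 , # 2) , (# 5 , # 2)) ∷ ((# 0 , # 1) , (# 4 , # 2)) ∷ ((# 3 , # 2) , (# 5 , # 2)) ∷ ((# 0 , # 2) , (# 4 , # 1)) ∷ ((# 0 , # 1) , (# 5 , # 2)) ∷ ((# 0 , # 2) , (# 3 , # 2)) ∷ ((# 1 , # 1) , (# 5 , # 2)) ∷ ((# 3 , # 1) , (# 5 , # 2)) ∷ ((# 1 , # 2) , (# 5 , # 1)) ∷ ((# 2 , # 2) , (# 5 , # 2)) ∷ ((# 3 , # 2) , (# 5 , # 1)) ∷ ((# 4 , # 1) , (# 5 , # 2)) ∷ ((# 1 , # 2) , (# 4 , # 2)) ∷ []) ∷
     (((# 0 , # 0) , (# 4 , # 3)) ∷ ((# 0 , # 2) , (# 4 , # 3)) ∷ ((# 0 , # 3) , (# 4 , # 3)) ∷ ((# 0 , # 0) , (# 5 , # 3)) ∷ ((# 0 , # 3) , (# 4 , # 0)) ∷ ((# 0 , # 3) , (# 4 , # 2)) ∷ ((# 0 , # 3) , (# 3 , # 3)) ∷ ((# 1 , # 3) , (# 5 , # 3)) ∷ ((# 0 , # 2) , (# 5 , # 3)) ∷ ((# 3 , # 0) , (# 5 , # 3)) ∷ ((# 3 , # 3) , (# 5 , # 3)) ∷ ((# 1 , # 0) , (# 5 , # 3)) ∷ ((# 1 , # 2) , (# 5 , # 3)) ∷ ((# 3 , # 2) , (# 5 , # 3)) ∷ ((# 1 , # 3) , (# 5 , # 0)) ∷ ((# 1 ,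 # 3) , (# 5 , # 2)) ∷ ((# 3 , # 3) , (# 5 , # 0)) ∷ ((# 0 , # 1) , (# 5 , # 3)) ∷ ((# 3 , # 3) , (# 5 , # 2)) ∷ ((# 4 , # 0) , (# 5 , # 3)) ∷ ((# 2 , # 3) , (# 5 , # 3)) ∷ ((# 4 , # 2) , (# 5 , # 3)) ∷ ((# 1 , # 3) , (# 4 , # 3)) ∷ ((# 5 , # 0) , (# 5 , # 2)) ∷ ((# 5 , # 1) , (# 5 , # 3)) ∷ []) ∷ [])

witness-6-4 : List (Fin 6 × Fin 4)
witness-6-4 = (# 0 , # 1) ∷ (# 1 , # 1) ∷ (# 3 , # 0) ∷ (# 4 , # 0) ∷ []

μ-6-4 : MuDTorusIs 6 4 4
μ-6-4 = TorusSearch.certified-μ 5 3 4 witness-6-4 schedule-6-4 refl _ _ _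

schedule-5-5 : List (List ((Fin 5 × Fin 5) × (Fin 5 × Fin 5)))
schedule-5-5 = ([] ∷
     [] ∷
     (((# 0 , # 0) , (# 0 , # 2)) ∷ []) ∷
     (((# 0 , # 1) , (# 0 , # 3)) ∷ []) ∷
     (((# 0 , # 0) , (# 0 , # 3)) ∷ ((# 0 , # 1) , (# 0 , # 4)) ∷ ((# 0 , # 2) , (# 0 , # 4)) ∷ []) ∷
     [] ∷
     (((# 0 , # 0) , (# 1 , # 1)) ∷ ((# 0 , # 1) , (# 1 , # 0)) ∷ []) ∷
     (((# 0 , # 0) , (# 1 , # 2)) ∷ ((# 1 , # 0) , (# 1 , # 2)) ∷ ((# 0 , # 1) , (# 1 , # 2)) ∷ ((# 0 , # 2) , (# 1 , # 0)) ∷ []) ∷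
     (((# 0 , # 1) , (# 1 , # 3)) ∷ ((# 1 , # 1) , (# 1 , # 3)) ∷ ((# 0 , # 2) , (# 1 , # 3)) ∷ ((# 0 , # 3) , (# 1 , # 1)) ∷ []) ∷
     (((# 0 , # 0) , (# 1 , # 3)) ∷ ((# 0 , # 2) , (# 1 , # 4)) ∷ ((# 0 , # 3) , (# 1 , # 0)) ∷ ((# 1 , # 0) , (# 1 , # 3)) ∷ ((# 0 , # 0) , (# 1 , # 4)) ∷ ((# 1 , # 1) , (# 1 , # 4)) ∷ ((# 0 , # 1) , (# 1 , # 4)) ∷ ((# 1 , # 2) , (# 1 , # 4)) ∷ ((# 0 , # 3) , (# 1 , # 4)) ∷ ((# 0 , # 4) , (# 1 , # 1)) ∷ ((# 0 , # 4) , (# 1 , # 2)) ∷ []) ∷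
     (((# 0 , # 0) , (# 2 , # 0)) ∷ []) ∷
     (((# 0 , # 0) , (# 2 , # 1)) ∷ ((# 0 , # 1) , (# 2 , # 1)) ∷ ((# 1 , # 0) , (# 2 , # 1)) ∷ []) ∷
     (((# 2 , # 0) , (# 2 , # 2)) ∷ ((# 0 , # 0) , (# 2 , # 2)) ∷ ((# 0 , # 2) , (# 2 , # 2)) ∷ ((# 1 , # 1) , (# 2 , # 2)) ∷ []) ∷
     (((# 2 , # 1) , (# 2 , # 3)) ∷ ((# 0 , # 1) , (# 2 , # 3)) ∷ ((# 0 , # 3) , (# 2 , # 3)) ∷ ((# 1 , # 2) , (# 2 , # 3)) ∷ []) ∷
     (((# 2 , # 0) , (# 2 , # 3)) ∷ ((# 2 , # 1) , (# 2 , # 4)) ∷ ((# 2 , # 2) , (# 2 , # 4)) ∷ ((# 0 , # 0) , (# 2 , # 4)) ∷ ((# 1 , # 0) , (# 2 , # 3)) ∷ ((# 1 , # 3) , (# 2 , # 0)) ∷ ((# 0 , # 2) , (# 2 , # 4)) ∷ ((# 1 , # 0) , (# 2 , # 4)) ∷ ((# 1 , # 3) , (# 2 , # 4)) ∷ []) ∷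
     (((# 1 , # 0) , (# 3 , # 0)) ∷ []) ∷
     (((# 1 , # 0) , (# 3 , # 1)) ∷ ((# 1 , # 1) , (# 3 , # 1)) ∷ ((# 2 , # 0) , (# 3 , # 1)) ∷ []) ∷
     (((# 3 , # 0) , (# 3 , # 2)) ∷ ((# 1 , # 0) , (# 3 , # 2)) ∷ ((# 1 , # 2) , (# 3 , # 2)) ∷ ((# 2 , # 1) , (# 3 , # 2)) ∷ []) ∷
     (((# 1 , # 1) , (# 3 , # 3)) ∷ ((# 3 , # 1) , (# 3 , # 3)) ∷ ((# 1 , # 3) , (# 3 , # 3)) ∷ ((# 2 , # 2) , (# 3 , # 3)) ∷ []) ∷
     (((# 1 , # 0) , (# 3 , # 4)) ∷ ((# 3 , # 0) , (# 3 , # 3)) ∷ ((# 3 , # 1) , (# 3 , # 4)) ∷ ((# 2 , # 0) , (# 3 , # 3)) ∷ ((# 2 , # 3) , (# 3 , # 0)) ∷ ((# 3 , # 2) , (# 3 , # 4)) ∷ ((# 1 , # 2) , (# 3 , # 4)) ∷ ((# 2 , # 0) , (# 3 , # 4)) ∷ ((# 2 , # 3) , (# 3 , # 4)) ∷ []) ∷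
     (((# 0 , # 0) , (# 3 , # 0)) ∷ ((# 1 , # 0) , (# 4 , # 0)) ∷ ((# 2 , # 0) , (# 4 , # 0)) ∷ []) ∷
     (((# 0 , # 1) , (# 3 , # 1)) ∷ ((# 0 , # 0) , (# 3 , # 1)) ∷ ((# 0 , # 1) , (# 3 , # 0)) ∷ ((# 0 , # 0) , (# 4 , # 1)) ∷ ((# 1 , # 1) , (# 4 , # 1)) ∷ ((# 1 , # 0) , (# 4 , # 1)) ∷ ((# 2 , # 0) , (# 4 , # 1)) ∷ ((# 2 , # 1) , (# 4 , # 1)) ∷ ((# 3 , # 0) , (# 4 , # 1)) ∷ []) ∷
     (((# 0 , # 2) , (# 3 , # 2)) ∷ ((# 0 , # 0) , (# 4 , # 2)) ∷ ((# 1 , # 2) , (# 4 , # 2)) ∷ ((# 2 , # 2) , (# 4 , # 2)) ∷ ((# 0 , # 1) , (# 4 , # 2)) ∷ ((# 2 , # 0) , (# 4 , # 2)) ∷ ((# 3 , # 1) , (# 4 , # 2)) ∷ ((# 0 , # 1) , (# 3 , # 2)) ∷ ((# 0 , # 2) , (# 3 , # 1)) ∷ []) ∷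
     (((# 0 , # 1) , (# 4 , # 3)) ∷ ((# 0 , # 3) , (# 3 , # 3)) ∷ ((# 1 , # 3) , (# 4 , # 3)) ∷ ((# 0 , # 2) , (# 4 , # 3)) ∷ ((# 2 , # 1) , (# 4 , # 3)) ∷ ((# 2 , # 3) , (# 4 , # 3)) ∷ ((# 3 , # 2) , (# 4 , # 3)) ∷ ((# 0 , # 2) , (# 3 , # 3)) ∷ ((# 0 , # 3) , (# 3 , # 2)) ∷ []) ∷
     (((# 0 , # 0) , (# 3 , # 3)) ∷ ((# 0 , # 0) , (# 4 , # 4)) ∷ ((# 0 , # 1) , (# 4 , # 4)) ∷ ((# 0 , # 2) , (# 4 , # 4)) ∷ ((# 0 , # 3) , (# 4 , # 4)) ∷ ((# 0 , # 4) , (# 3 , # 4)) ∷ ((# 2 , # 0) , (# 4 , # 4)) ∷ ((# 2 , # 2) , (# 4 , # 4)) ∷ ((# 3 , # 0) , (# 4 , # 4)) ∷ ((# 3 , # 3) , (# 4 , # 4)) ∷ []) ∷ [])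

μ-5-5 : MuDTorusIs 5 5 0
μ-5-5 = TorusSearch.certified-μ≡0 4 4 schedule-5-5 _ _

schedule-6-5 : List (List ((Fin 6 × Fin 5) × (Fin 6 × Fin 5)))
schedule-6-5 = ([] ∷
     [] ∷
     (((# 0 , # 0) , (# 0 , # 2)) ∷ []) ∷
     (((# 0 , # 1) , (# 0 , # 3)) ∷ []) ∷
     (((# 0 , # 0) , (# 0 , # 3)) ∷ ((# 0 , # 1) , (# 0 , # 4)) ∷ ((# 0 , # 2) , (# 0 , # 4)) ∷ []) ∷
     [] ∷
     (((# 0 , # 0) , (# 1 , # 1)) ∷ ((# 0 , # 1) , (# 1 , # 0)) ∷ []) ∷
     (((# 0 , # 0) , (# 1 , # 2)) ∷ ((# 1 , # 0) , (# 1 , # 2)) ∷ ((# 0 , # 1) , (# 1 , # 2)) ∷ ((# 0 , # 2) , (# 1 , # 0)) ∷ []) ∷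
     (((# 0 , # 1) , (# 1 , # 3)) ∷ ((# 1 , # 1) , (# 1 , # 3)) ∷ ((# 0 , # 2) , (# 1 , # 3)) ∷ ((# 0 , # 3) , (# 1 , # 1)) ∷ []) ∷
     (((# 0 , # 0) , (# 1 , # 3)) ∷ ((# 0 , # 2) , (# 1 , # 4)) ∷ ((# 0 , # 3) , (# 1 , # 0)) ∷ ((# 1 , # 0) , (# 1 , # 3)) ∷ ((# 0 , # 0) , (# 1 , # 4)) ∷ ((# 1 , # 1) , (# 1 , # 4)) ∷ ((# 0 , # 1) , (# 1 , # 4)) ∷ ((# 1 , # 2) , (# 1 , # 4)) ∷ ((# 0 , # 3) , (# 1 , # 4)) ∷ ((# 0 , # 4) , (# 1 , # 1)) ∷ ((# 0 , # 4) , (# 1 , # 2)) ∷ []) ∷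
     (((# 0 , # 0) , (# 2 , # 0)) ∷ []) ∷
     (((# 0 , # 0) , (# 2 , # 1)) ∷ ((# 0 , # 1) , (# 2 , # 1)) ∷ ((# 1 , # 0) , (# 2 , # 1)) ∷ []) ∷
     (((# 2 , # 0) , (# 2 , # 2)) ∷ ((# 0 , # 0) , (# 2 , # 2)) ∷ ((# 0 , # 2) , (# 2 , # 2)) ∷ ((# 1 , # 1) , (# 2 , # 2)) ∷ []) ∷
     (((# 2 , # 1) , (# 2 , # 3)) ∷ ((# 0 , # 1) , (# 2 , # 3)) ∷ ((# 0 , # 3) , (# 2 , # 3)) ∷ ((# 1 , # 2) , (# 2 , # 3)) ∷ []) ∷
     (((# 2 , # 0) , (# 2 , # 3)) ∷ ((# 2 , # 1) , (# 2 , # 4)) ∷ ((# 2 , # 2) , (# 2 , # 4)) ∷ ((# 0 , # 0) , (# 2 , # 4)) ∷ ((# 1 , # 0) , (# 2 , # 3)) ∷ ((# 1 , # 3) , (# 2 , # 0)) ∷ ((# 0 , # 2) , (# 2 , # 4)) ∷ ((# 1 , # 0) , (# 2 , # 4)) ∷ ((# 1 , # 3) , (# 2 , # 4)) ∷ []) ∷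
     (((# 1 , # 0) , (# 3 , # 0)) ∷ []) ∷
     (((# 1 , # 0) , (# 3 , # 1)) ∷ ((# 1 , # 1) , (# 3 , # 1)) ∷ ((# 2 , # 0) , (# 3 , # 1)) ∷ []) ∷
     (((# 3 , # 0) , (# 3 , # 2)) ∷ ((# 1 , # 0) , (# 3 , # 2)) ∷ ((# 1 , # 2) , (# 3 , # 2)) ∷ ((# 2 , # 1) , (# 3 , # 2)) ∷ []) ∷
     (((# 1 , # 1) , (# 3 , # 3)) ∷ ((# 3 , # 1) , (# 3 , # 3)) ∷ ((# 1 , # 3) , (# 3 , # 3)) ∷ ((# 2 , # 2) , (# 3 , # 3)) ∷ []) ∷
     (((# 1 , # 0) , (# 3 , # 4)) ∷ ((# 3 , # 0) , (# 3 , # 3)) ∷ ((# 3 , # 1) , (# 3 , # 4)) ∷ ((# 2 , # 0) , (# 3 , # 3)) ∷ ((# 2 , # 3) , (# 3 , # 0)) ∷ ((# 3 , # 2) , (# 3 , # 4)) ∷ ((# 1 , # 2) , (# 3 , # 4)) ∷ ((# 2 , # 0) , (# 3 , # 4)) ∷ ((# 2 , # 3) , (# 3 , # 4)) ∷ []) ∷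
     (((# 2 , # 0) , (# 4 , # 0)) ∷ []) ∷
     (((# 2 , # 0) , (# 4 , # 1)) ∷ ((# 2 , # 1) , (# 4 , # 1)) ∷ ((# 3 , # 0) , (# 4 , # 1)) ∷ []) ∷
     (((# 4 , # 0) , (# 4 , # 2)) ∷ ((# 2 , # 0) , (# 4 , # 2)) ∷ ((# 2 , # 2) , (# 4 , # 2)) ∷ ((# 3 , # 1) , (# 4 , # 2)) ∷ []) ∷
     (((# 2 , # 1) , (# 4 , # 3)) ∷ ((# 4 , # 1) , (# 4 , # 3)) ∷ ((# 2 , # 3) , (# 4 , # 3)) ∷ ((# 3 , # 2) , (# 4 , # 3)) ∷ []) ∷
     (((# 2 , # 0) , (# 4 , # 4)) ∷ ((# 4 , # 0) , (# 4 , # 3)) ∷ ((# 4 , # 1) , (# 4 , # 4)) ∷ ((# 3 , # 0) , (# 4 , # 3)) ∷ ((# 3 , # 3) , (# 4 , # 0)) ∷ ((# 4 , # 2) , (# 4 , # 4)) ∷ ((# 2 , # 2) , (# 4 , # 4)) ∷ ((# 3 , # 0) , (# 4 , # 4)) ∷ ((# 3 , # 3) , (# 4 , # 4)) ∷ []) ∷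
     (((# 0 , # 0) , (# 4 , # 0)) ∷ ((# 1 , # 0) , (# 5 , # 0)) ∷ ((# 3 , # 0) , (# 5 , # 0)) ∷ []) ∷
     (((# 0 , # 1) , (# 4 , # 1)) ∷ ((# 0 , # 0) , (# 4 , # 1)) ∷ ((# 0 , # 1) , (# 4 , # 0)) ∷ ((# 0 , # 0) , (# 5 , # 1)) ∷ ((# 1 , # 1) , (# 5 , # 1)) ∷ ((# 1 , # 0) , (# 5 , # 1)) ∷ ((# 3 , # 0) , (# 5 , # 1)) ∷ ((# 3 , # 1) , (# 5 , # 1)) ∷ ((# 4 , # 0) , (# 5 , # 1)) ∷ []) ∷
     (((# 0 , # 2) , (# 4 , # 2)) ∷ ((# 0 , # 0) , (# 5 , # 2)) ∷ ((# 1 , # 2) , (# 5 , # 2)) ∷ ((# 3 , # 2) , (# 5 , # 2)) ∷ ((# 0 , # 1) , (# 5 , # 2)) ∷ ((# 3 , # 0) , (# 5 , # 2)) ∷ ((# 4 , # 1) , (# 5 , # 2)) ∷ ((# 0 , # 1) , (# 4 , # 2)) ∷ ((# 0 , # 2) , (# 4 , # 1)) ∷ []) ∷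
     (((# 0 , # 1) , (# 5 , # 3)) ∷ ((# 0 , # 3) , (# 4 , # 3)) ∷ ((# 1 , # 3) , (# 5 , # 3)) ∷ ((# 0 , # 2) , (# 5 , # 3)) ∷ ((# 3 , # 1) , (# 5 , # 3)) ∷ ((# 3 , # 3) , (# 5 , # 3)) ∷ ((# 4 , # 2) , (# 5 , # 3)) ∷ ((# 0 , # 2) , (# 4 , # 3)) ∷ ((# 0 , # 3) , (# 4 , # 2)) ∷ []) ∷
     (((# 0 , # 0) , (# 4 , # 3)) ∷ ((# 0 , # 0) , (# 5 , # 4)) ∷ ((# 0 , # 1) , (# 5 , # 4)) ∷ ((# 0 , # 2) , (# 5 , # 4)) ∷ ((# 0 , # 3) , (# 5 , # 4)) ∷ ((# 0 , # 4) , (# 4 , # 4)) ∷ ((# 3 , # 0) , (# 5 , # 4)) ∷ ((# 3 , # 2) , (# 5 , # 4)) ∷ ((# 4 , # 0) , (# 5 , # 4)) ∷ ((# 4 , # 3) , (# 5 , # 4)) ∷ []) ∷ [])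

μ-6-5 : MuDTorusIs 6 5 0
μ-6-5 = TorusSearch.certified-μ≡0 5 4 schedule-6-5 _ _

schedule-6-6 : List (List ((Fin 6 × Fin 6) × (Fin 6 × Fin 6)))
schedule-6-6 = ([] ∷
     [] ∷
     (((# 0 , # 0) , (# 0 , # 2)) ∷ []) ∷
     (((# 0 , # 1) , (# 0 , # 3)) ∷ []) ∷
     (((# 0 , # 2) , (# 0 , # 4)) ∷ []) ∷
     (((# 0 , # 0) , (# 0 , # 3)) ∷ ((# 0 , # 0) , (# 0 , # 4)) ∷ ((# 0 , # 1) , (# 0 , # 5)) ∷ ((# 0 , # 3) , (# 0 , # 5)) ∷ ((# 0 , # 1) , (# 0 , # 4)) ∷ ((# 0 , # 2) , (# 0 , # 5)) ∷ []) ∷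
     [] ∷
     (((# 0 , # 0) , (# 1 , # 1)) ∷ ((# 0 , # 1) , (# 1 , # 0)) ∷ []) ∷
     (((# 1 , # 0) , (# 1 , # 2)) ∷ ((# 0 , # 0) , (# 1 , # 2)) ∷ ((# 0 , # 1) , (# 1 , # 2)) ∷ ((# 0 , # 2) , (# 1 , # 0)) ∷ []) ∷
     (((# 1 , # 1) , (# 1 , # 3)) ∷ ((# 0 , # 1) , (# 1 , # 3)) ∷ ((# 0 , # 2) , (# 1 , # 3)) ∷ ((# 0 , # 3) , (# 1 , # 1)) ∷ []) ∷
     (((# 1 , # 2) , (# 1 , # 4)) ∷ ((# 0 , # 2) , (# 1 , # 4)) ∷ ((# 0 , # 3) , (# 1 , # 4)) ∷ ((# 0 , # 4) , (# 1 , # 2)) ∷ []) ∷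
     (((# 0 , # 0) , (# 1 , # 4)) ∷ ((# 0 , # 4) , (# 1 , # 0)) ∷ ((# 0 , # 3) , (# 1 , # 5)) ∷ ((# 0 , # 0) , (# 1 , # 5)) ∷ ((# 1 , # 0) , (# 1 , # 4)) ∷ ((# 0 , # 1) , (# 1 , # 5)) ∷ ((# 1 , # 0) , (# 1 , # 3)) ∷ ((# 1 , # 1) , (# 1 , # 5)) ∷ ((# 1 , # 3) , (# 1 , # 5)) ∷ ((# 0 , # 4) , (# 1 , # 5)) ∷ ((# 0 , # 5) , (# 1 , # 1)) ∷ ((# 0 , # 5) , (# 1 , # 3)) ∷ ((# 1 , # 1) , (# 1 , # 4)) ∷ ((# 1 , # 2) , (# 1 , # 5)) ∷ []) ∷
     (((# 0 , # 0) , (# 2 , # 0)) ∷ []) ∷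
     (((# 0 , # 0) , (# 2 , # 1)) ∷ ((# 0 , # 1) , (# 2 , # 1)) ∷ ((# 1 , # 0) , (# 2 , # 1)) ∷ []) ∷
     (((# 2 , # 0) , (# 2 , # 2)) ∷ ((# 0 , # 0) , (# 2 , # 2)) ∷ ((# 0 , # 2) , (# 2 , # 2)) ∷ ((# 1 , # 1) , (# 2 , # 2)) ∷ ((# 0 , # 1) , (# 2 , # 2)) ∷ ((# 0 , # 2) , (# 2 , # 0)) ∷ []) ∷
     (((# 2 , # 1) , (# 2 , # 3)) ∷ ((# 0 , # 1) , (# 2 , # 3)) ∷ ((# 0 , # 3) , (# 2 , # 3)) ∷ ((# 1 , # 2) , (# 2 , # 3)) ∷ ((# 0 , # 2) , (# 2 , # 3)) ∷ []) ∷
     (((# 2 , # 2) , (# 2 , # 4)) ∷ ((# 0 , # 2) , (# 2 , # 4)) ∷ ((# 0 , # 4) , (# 2 , # 4)) ∷ ((# 1 , # 3) , (# 2 , # 4)) ∷ ((# 0 , # 3) , (# 2 , # 4)) ∷ []) ∷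
     (((# 2 , # 0) , (# 2 , # 3)) ∷ ((# 2 , # 0) , (# 2 , # 4)) ∷ ((# 2 , # 1) , (# 2 , # 5)) ∷ ((# 0 , # 0) , (# 2 , # 5)) ∷ ((# 2 , # 3) , (# 2 , # 5)) ∷ ((# 2 , # 1) , (# 2 , # 4)) ∷ ((# 2 , # 2) , (# 2 , # 5)) ∷ ((# 0 , # 3) , (# 2 , # 5)) ∷ ((# 1 , # 0) , (# 2 , # 5)) ∷ ((# 1 , # 4) , (# 2 , # 5)) ∷ ((# 1 , # 0) , (# 2 , # 4)) ∷ ((# 1 , # 4) , (# 2 , # 0)) ∷ ((# 0 , # 1) , (# 2 , # 5)) ∷ ((# 0 , # 2) , (# 2 , # 5)) ∷ []) ∷
     (((# 1 , # 0) , (# 3 , # 0)) ∷ []) ∷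
     (((# 1 , # 0) , (# 3 , # 1)) ∷ ((# 1 , # 1) , (# 3 , # 1)) ∷ ((# 2 , # 0) , (# 3 , # 1)) ∷ []) ∷
     (((# 3 , # 0) , (# 3 , # 2)) ∷ ((# 1 , # 0) , (# 3 , # 2)) ∷ ((# 1 , # 2) , (# 3 , # 2)) ∷ ((# 2 , # 1) , (# 3 , # 2)) ∷ []) ∷
     (((# 3 , # 1) , (# 3 , # 3)) ∷ ((# 1 , # 1) , (# 3 , # 3)) ∷ ((# 1 , # 3) , (# 3 , # 3)) ∷ ((# 2 , # 2) , (# 3 , # 3)) ∷ []) ∷
     (((# 1 , # 2) , (# 3 , # 4)) ∷ ((# 3 , # 2) , (# 3 , # 4)) ∷ ((# 2 , # 3) , (# 3 , # 4)) ∷ ((# 1 , # 4) , (# 3 , # 4)) ∷ []) ∷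
     (((# 1 , # 0) , (# 3 , # 5)) ∷ ((# 3 , # 0) , (# 3 , # 3)) ∷ ((# 3 , # 0) , (# 3 , # 4)) ∷ ((# 2 , # 0) , (# 3 , # 4)) ∷ ((# 2 , # 4) , (# 3 , # 0)) ∷ ((# 3 , # 1) , (# 3 , # 5)) ∷ ((# 1 , # 3) , (# 3 , # 5)) ∷ ((# 2 , # 0) , (# 3 , # 5)) ∷ ((# 2 , # 4) , (# 3 , # 5)) ∷ ((# 3 , # 3) , (# 3 , # 5)) ∷ ((# 3 , # 1) , (# 3 , # 4)) ∷ ((# 3 , # 2) , (# 3 , # 5)) ∷ []) ∷
     (((# 2 , # 0) , (# 4 , # 0)) ∷ []) ∷
     (((# 2 , # 0) , (# 4 , # 1)) ∷ ((# 2 , # 1) , (# 4 , # 1)) ∷ ((# 3 , # 0) , (# 4 , # 1)) ∷ []) ∷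
     (((# 4 , # 0) , (# 4 , # 2)) ∷ ((# 2 , # 0) , (# 4 , # 2)) ∷ ((# 2 , # 2) , (# 4 , # 2)) ∷ ((# 3 , # 1) , (# 4 , # 2)) ∷ []) ∷
     (((# 4 , # 1) , (# 4 , # 3)) ∷ ((# 2 , # 1) , (# 4 , # 3)) ∷ ((# 2 , # 3) , (# 4 , # 3)) ∷ ((# 3 , # 2) , (# 4 , # 3)) ∷ []) ∷
     (((# 2 , # 2) , (# 4 , # 4)) ∷ ((# 4 , # 2) , (# 4 , # 4)) ∷ ((# 3 , # 3) , (# 4 , # 4)) ∷ ((# 2 , # 4) , (# 4 , # 4)) ∷ []) ∷
     (((# 2 , # 0) , (# 4 , # 5)) ∷ ((# 4 , # 0) , (# 4 , # 3)) ∷ ((# 4 , # 0) , (# 4 , # 4)) ∷ ((# 3 , # 0) , (# 4 , # 4)) ∷ ((# 3 , # 4) , (# 4 , # 0)) ∷ ((# 4 , # 1) , (# 4 , # 5)) ∷ ((# 2 , # 3) , (# 4 , # 5)) ∷ ((# 3 , # 0) , (# 4 , # 5)) ∷ ((# 3 , # 4) , (# 4 , # 5)) ∷ ((# 4 , # 3) , (# 4 , # 5)) ∷ ((# 4 , # 1) , (# 4 , # 4)) ∷ ((# 4 , # 2) , (# 4 , # 5)) ∷ []) ∷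
     (((# 0 , # 0) , (# 4 , # 0)) ∷ ((# 1 , # 0) , (# 5 , # 0)) ∷ ((# 3 , # 0) , (# 5 , # 0)) ∷ []) ∷
     (((# 0 , # 1) , (# 4 , # 1)) ∷ ((# 0 , # 0) , (# 4 , # 1)) ∷ ((# 0 , # 1) , (# 4 , # 0)) ∷ ((# 0 , # 0) , (# 5 , # 1)) ∷ ((# 1 , # 1) , (# 5 , # 1)) ∷ ((# 1 , # 0) , (# 5 , # 1)) ∷ ((# 3 , # 0) , (# 5 , # 1)) ∷ ((# 3 , # 1) , (# 5 , # 1)) ∷ ((# 4 , # 0) , (# 5 , # 1)) ∷ []) ∷
     (((# 0 , # 2) , (# 4 , # 2)) ∷ ((# 0 , # 0) , (# 5 , # 2)) ∷ ((# 1 , # 2) , (# 5 , # 2)) ∷ ((# 3 , # 2) , (# 5 , # 2)) ∷ ((# 0 , # 1) , (# 5 , # 2)) ∷ ((# 3 , # 0) , (# 5 , # 2)) ∷ ((# 4 , # 1) , (# 5 , # 2)) ∷ ((# 0 , # 1) , (# 4 , # 2)) ∷ ((# 0 , # 2) , (# 4 , # 1)) ∷ []) ∷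
     (((# 0 , # 3) , (# 4 , # 3)) ∷ ((# 0 , # 1) , (# 5 , # 3)) ∷ ((# 1 , # 3) , (# 5 , # 3)) ∷ ((# 0 , # 2) , (# 5 , # 3)) ∷ ((# 3 , # 1) , (# 5 , # 3)) ∷ ((# 3 , # 3) , (# 5 , # 3)) ∷ ((# 4 , # 2) , (# 5 , # 3)) ∷ ((# 0 , # 2) , (# 4 , # 3)) ∷ ((# 0 , # 3) , (# 4 , # 2)) ∷ []) ∷
     (((# 0 , # 2) , (# 5 , # 4)) ∷ ((# 0 , # 4) , (# 4 , # 4)) ∷ ((# 1 , # 4) , (# 5 , # 4)) ∷ ((# 0 , # 3) , (# 5 , # 4)) ∷ ((# 3 , # 2) , (# 5 , # 4)) ∷ ((# 3 , # 4) , (# 5 , # 4)) ∷ ((# 4 , # 3) , (# 5 , # 4)) ∷ ((# 0 , # 3) , (# 4 , # 4)) ∷ ((# 0 , # 4) , (# 4 , # 3)) ∷ []) ∷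
     (((# 0 , # 0) , (# 4 , # 4)) ∷ ((# 0 , # 0) , (# 5 , # 5)) ∷ ((# 0 , # 1) , (# 5 , # 5)) ∷ ((# 0 , # 3) , (# 5 , # 5)) ∷ ((# 0 , # 4) , (# 5 , # 5)) ∷ ((# 0 , # 5) , (# 4 , # 5)) ∷ ((# 3 , # 0) , (# 5 , # 5)) ∷ ((# 3 , # 3) , (# 5 , # 5)) ∷ ((# 4 , # 0) , (# 5 , # 5)) ∷ ((# 4 , # 4) , (# 5 , # 5)) ∷ []) ∷ [])

μ-6-6 : MuDTorusIs 6 6 0
μ-6-6 = TorusSearch.certified-μ≡0 5 5 schedule-6-6 _ _

μ-long : ∀ k l → MuDTorusIs (7 + k) (suc l) 0
μ-long k l = TorusSubsets.only-∅⇒μ≡0 (6 + k) l (λ Y dmv → LongCycle.long-cycle⇒empty k l dmv)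

theorem4p6 : ∀ (n m : ℕ) → 3 ≤ m → m ≤ n → MuDTorusIs n m (expected n m)
theorem4p6 (suc (suc (suc (suc (suc (suc (suc k))))))) (suc l) _ _ = μ-long k l
theorem4p6 _ zero () _
theorem4p6 _ (suc zero) (s≤s ()) _
theorem4p6 _ (suc (suc zero)) (s≤s (s≤s ())) _
theorem4p6 3 3 _ _ = μ-3-3
theorem4p6 4 3 _ _ = μ-4-3
theorem4p6 4 4 _ _ = μ-4-4
theorem4p6 5 3 _ _ = μ-5-3
theorem4p6 5 4 _ _ = μ-5-4
theorem4p6 5 5 _ _ = μ-5-5
theorem4p6 6 3 _ _ = μ-6-3
theorem4p6 6 4 _ _ = μ-6-4
theorem4p6 6 5 _ _ = μ-6-5
theorem4p6 6 6 _ _ = μ-6-6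
theorem4p6 3 (suc (suc (suc (suc m)))) _ (s≤s (s≤s (s≤s ())))
theorem4p6 4 (suc (suc (suc (suc (suc m))))) _ (s≤s (s≤s (s≤s (s≤s ()))))
theorem4p6 5 (suc (suc (suc (suc (suc (suc m)))))) _ (s≤s (s≤s (s≤s (s≤s (s≤s ())))))
theorem4p6 6 (suc (suc (suc (suc (suc (suc (suc m))))))) _ (s≤s (s≤s (s≤s (s≤s (s≤s (s≤s ()))))))
theorem4p6 zero (suc (suc (suc m))) _ ()
theorem4p6 1 (suc (suc (suc m))) _ (s≤s ())
theorem4p6 2 (suc (suc (suc m))) _ (s≤s (s≤s ()))
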